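{- Let $m$ be a positive integer and $p$ a prime with $p>m$; let $q=\lfloor p/m\rfloor$. Define $f_{m,p,i}$ ($0\le i\le\varphi(m)-1$) and $f_{m,p,i,j}$ ($0\le j\le q$) by $$\Phi_{mp}=\sum_{i=0}^{\varphi(m)-1}f_{m,p,i}\,x^{ip},\ \deg f_{m,p,i}<p,\qquad f_{m,p,i}=\sum_{j=0}^{q}f_{m,p,i,j}\,x^{jm},\ \deg f_{m,p,i,j}<m.$$ For $1\le i\le\varphi(m)-1$ let $g^{\mathsf b}_{p,i}=p+\operatorname{tdeg}f_{m,p,i}-\deg f_{m,p,i-1}$ (the gap in $\Phi_{mp}$ between the blocks $f_{m,p,i-1}$ and $f_{m,p,i}$), and let $g^{\mathsf b}_{p,0}=0$. Then $g^{\mathsf b}_{p,i}\le\varphi(m)$ for every $0\le i\le\varphi(m)-1$.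
   Context: $\Phi_n$ is the $n$-th cyclotomic polynomial and $\varphi$ is Euler's totient function. For a nonzero polynomial $f$, $\operatorname{tdeg}f$ is the smallest exponent whose coefficient in $f$ is nonzero. -}

module Defs where

open import Data.Nat as ℕ using (ℕ; zero; suc; _∸_; _<_; _≤_)
open import Data.Nat.Divisibility using (_∣?_)
open import Data.Nat.GCD using (gcd)
open import Data.Integer as ℤ using (ℤ; +_; -_; _-_)
open import Data.List using (List; []; _∷_; _++_; [_]; map; filter; length; reverse; replicate; zipWith; drop; foldr)
open import Data.List.Base using (upTo)
open import Data.Product using (Σ; _×_; _,_)
open import Relation.Nullary using (¬_)
open import Relation.Binary.PropositionalEquality using (_≡_)

-- Integer polynomials as little-endian coefficient lists (trailing zeros allowed).
Poly : Set
Poly = List ℤ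

coeff : Poly → ℕ → ℤ
coeff []       _       = + 0
coeff (a ∷ _)  zero    = a
coeff (_ ∷ f)  (suc k) = coeff f k

addP : Poly → Poly → Poly
addP []       g        = g
addP f        []       = f
addP (a ∷ f)  (b ∷ g)  = (a ℤ.+ b) ∷ addP f g

mulP : Poly → Poly → Poly
mulP []      g = []
mulP (a ∷ f) g = addP (map (a ℤ.*_) g) (+ 0 ∷ mulP f g)

xPowMinusOne : ℕ → Poly
xPowMinusOne zero    = []
xPowMinusOne (suc n) = - (+ 1) ∷ (replicate n (+ 0) ++ [ + 1 ])

dot : List ℤ → List ℤ → ℤ
dot f g = foldr ℤ._+_ (+ 0) (zipWith ℤ._*_ f g)

-- Exact division P / D for D with constant term u ∈ {1, -1}, computed as the
-- power-series quotient q_k = u * (p_k - Σ_{j≥1} d_j q_{k-j}), k < length P.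
-- When D divides P this yields the polynomial quotient (padded with zeros).
divExact : Poly → Poly → Poly
divExact P D = reverse (go (length P))
  where
  u : ℤ
  u = coeff D 0
  go : ℕ → List ℤ
  go zero    = []
  go (suc k) = let acc = go k in (u ℤ.* (coeff P k - dot (drop 1 D) acc)) ∷ acc

-- product of the entries L[d-1] over 1 ≤ d ≤ length L with d ∣ N
prodDivisors : ℕ → List Poly → Poly
prodDivisors N L = go 1 L
  where
  go : ℕ → List Poly → Poly
  go d []       = [ + 1 ]
  go d (f ∷ fs) with d ∣? N
  ... | Relation.Nullary.yes _ = mulP f (go (suc d) fs)
  ... | Relation.Nullary.no  _ = go (suc d) fs

-- cycloTable n = [Φ_1, …, Φ_n], with  Φ_n = (x^n - 1) / ∏_{d ∣ n, d < n} Φ_d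
cycloTable : ℕ → List Poly
cycloTable zero    = []
cycloTable (suc n) = cycloTable n ++ [ divExact (xPowMinusOne (suc n)) (prodDivisors (suc n) (cycloTable n)) ]

nth : List Poly → ℕ → Poly
nth []       _       = []
nth (f ∷ _)  zero    = f
nth (_ ∷ fs) (suc k) = nth fs k

-- n-th cyclotomic polynomial Φ_n (n ≥ 1; Φ 0 is a junk value, the zero polynomial)
Φ : ℕ → Poly
Φ n = nth (cycloTable n) (n ∸ 1)

φ : ℕ → ℕ
φ m = length (filter (λ k → gcd k m ℕ.≟ 1) (map suc (upTo m)))

IsTdeg : Poly → ℕ → Set
IsTdeg f a = ¬ (coeff f a ≡ + 0) × (∀ k → k < a → coeff f k ≡ + 0)

IsDeg : Poly → ℕ → Set
IsDeg f b = ¬ (coeff f b ≡ + 0) × (∀ k → b < k → coeff f k ≡ + 0)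

block : ℕ → ℕ → ℕ → Poly
block m p i = map (λ k → coeff (Φ (m ℕ.* p)) (i ℕ.* p ℕ.+ k)) (upTo p)

IsGapB : ℕ → ℕ → ℕ → ℤ → Set
IsGapB m p zero    g = g ≡ + 0
IsGapB m p (suc i) g =
  Σ ℕ λ a → Σ ℕ λ b → IsTdeg (block m p (suc i)) a × IsDeg (block m p i) b
    × g ≡ (+ p ℤ.+ + a) - + b

module Submission where

-- Since p ∤ m is prime, Φ m (x ^ p) = Φ m · Φ (m p); hence Φ m · Φ (m p) has non-zero
-- coefficients only at multiples of p. Suppose Φ (m p) had zero coefficients at all indices
-- strictly between s = (i-1) p + deg f_{i-1} and t = i p + tdeg f_i, with t - s > φ m = deg Φ m.
-- Then the coefficient of Φ m · Φ (m p) at s + φ m is the single term (lead Φ m) · c_s, and the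
-- one at t is the single term Φ m (0) · c_t; both are non-zero, and one of s + φ m, t is not
-- a multiple of p (t is not unless tdeg f_i = 0, and then s + φ m lies strictly inside a block).
--
-- For the table-defined Φ this needs x ^ n - 1 = ∏_{d ∣ n} Φ d, Φ n (0) = ±1 and deg Φ n = φ n.
-- They are proved together by induction on n: the Φ d (d ∣ n, d < n) are pairwise coprime over
-- ℚ, because x ^ d - 1 and x ^ e - 1 have the Bézout combination x ^ gcd - 1, so their product
-- divides x ^ n - 1; the exact division then returns the quotient, and Gauss's identity
-- ∑_{d ∣ n} φ d = n gives its degree.

open import Defs
open import Data.Nat using (ℕ; _<_; _≤_)
open import Data.Nat.Primality using (Prime)
open import Data.Integer using (ℤ; +_)
open import Data.Integer as ℤ using ()

open import Data.Nat.Coprimality using (Coprime; coprime-divisor)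
open import Data.Nat.Primality using (prime⇒irreducible; prime⇒nonZero)
open import Algebra.Bundles using (CommutativeRing; CommutativeMonoid)
open import Data.Integer using (_+_; _*_; -_; _-_; 0ℤ; 1ℤ)
import Data.Integer.Properties as ℤ
open import Data.Integer.Solver using (module +-*-Solver)
open import Data.List using (List; []; _∷_; _++_; [_]; map; length; filter; reverse; replicate; applyUpTo; applyDownFrom)
open import Data.List.Properties using (reverse-applyDownFrom; length-++; filter-++; applyUpTo-∷ʳ; map-upTo)
open import Data.Maybe using (Maybe; just; nothing)
open import Data.Nat as ℕ using (zero; suc; _∸_; z≤n; s≤s)
import Data.Nat.Properties as ℕ
open import Data.Nat.Divisibility using (_∣_; _∣?_; divides; ∣-refl; ∣-trans; ∣-antisym; ∣m∣n⇒∣m+n; ∣m⇒∣m*n; *-monoˡ-∣; *-cancelʳ-∣; ∣⇒≤; ∣m+n∣m⇒∣n; n∣m*n)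
open import Data.Nat.GCD using (gcd; gcd-zeroˡ; GCD; module Bézout; gcd[m,n]∣m; gcd[m,n]∣n; gcd[m,n]≢0; c*gcd[m,n]≡gcd[cm,cn])
open import Data.Product using (Σ; _×_; _,_; proj₁; proj₂)
open import Data.Sum using (_⊎_; inj₁; inj₂; [_,_]′)
open import Data.Empty using (⊥; ⊥-elim)
open import Function using (_∘_; id)
open import Relation.Binary.Definitions using (tri<; tri≈; tri>)
open import Relation.Binary.PropositionalEquality hiding ([_])
import Relation.Binary.PropositionalEquality as ≡
open import Relation.Binary.Structures using (IsEquivalence)
import Relation.Binary.Reasoning.Setoid
open import Relation.Nullary using (Dec; yes; no; ¬_)
open import Relation.Nullary.Decidable using (_×-dec_; ¬?; toSum)
import Tactic.RingSolver.Core.AlmostCommutativeRing as ACR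

open +-*-Solver using (solve; _:=_; _:+_; _:*_; _:-_)

InRange : ℕ → ℕ → Set
InRange n d = 1 ≤ d × d ≤ n

InRange-suc : ∀ {n d} → InRange n d → InRange (suc n) d
InRange-suc (1≤d , d≤n) = 1≤d , ℕ.m≤n⇒m≤1+n d≤n

InRange-top : ∀ n → InRange (suc n) (suc n)
InRange-top n = s≤s z≤n , ℕ.≤-refl

module RangeFold {c ℓ} (M : CommutativeMonoid c ℓ) where
  module Mon = CommutativeMonoid M
  open Mon using (Carrier; _≈_; _∙_; ε; ∙-cong; assoc; identityˡ; identityʳ)
  open import Algebra.Properties.CommutativeSemigroup Mon.commutativeSemigroup using (interchange)
  open import Relation.Binary.Reasoning.Setoid Mon.setoid

  fold : ℕ → (ℕ → Carrier) → Carrier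
  fold zero    f = ε
  fold (suc n) f = fold n f ∙ f (suc n)

  fold-cong : ∀ n {f g : ℕ → Carrier} → (∀ d → InRange n d → f d ≈ g d) → fold n f ≈ fold n g
  fold-cong zero    f≈g = Mon.refl
  fold-cong (suc n) f≈g = ∙-cong (fold-cong n (λ d → f≈g d ∘ InRange-suc)) (f≈g (suc n) (InRange-top n))

  fold-∙ : ∀ n (f g : ℕ → Carrier) → fold n (λ d → f d ∙ g d) ≈ fold n f ∙ fold n g
  fold-∙ zero    f g = Mon.sym (identityˡ ε)
  fold-∙ (suc n) f g = Mon.trans (∙-cong (fold-∙ n f g) Mon.refl) (interchange _ _ _ _)

  fold-ε : ∀ n (f : ℕ → Carrier) → (∀ d → InRange n d → f d ≈ ε) → fold n f ≈ ε
  fold-ε zero    f f≈ε = Mon.refl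
  fold-ε (suc n) f f≈ε = Mon.trans (∙-cong (fold-ε n f (λ d → f≈ε d ∘ InRange-suc)) (f≈ε (suc n) (InRange-top n))) (identityˡ ε)

  fold-+ : ∀ a b (f : ℕ → Carrier) → fold (a ℕ.+ b) f ≈ fold a f ∙ fold b (λ i → f (a ℕ.+ i))
  fold-+ a zero    f = Mon.trans (Mon.reflexive (≡.cong (λ n → fold n f) (ℕ.+-identityʳ a))) (Mon.sym (identityʳ _))
  fold-+ a (suc b) f = begin
    fold (a ℕ.+ suc b) f                                              ≡⟨ ≡.cong (λ n → fold n f) (ℕ.+-suc a b) ⟩
    fold (a ℕ.+ b) f ∙ f (suc (a ℕ.+ b))                              ≈⟨ ∙-cong (fold-+ a b f) Mon.refl ⟩
    (fold a f ∙ fold b (λ i → f (a ℕ.+ i))) ∙ f (suc (a ℕ.+ b))       ≈⟨ assoc _ _ _ ⟩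
    fold a f ∙ (fold b (λ i → f (a ℕ.+ i)) ∙ f (suc (a ℕ.+ b)))       ≡⟨ ≡.cong (λ n → fold a f ∙ (fold b (λ i → f (a ℕ.+ i)) ∙ f n)) (ℕ.+-suc a b) ⟨
    fold a f ∙ fold (suc b) (λ i → f (a ℕ.+ i))                       ∎

  fold-extend : ∀ n t (f : ℕ → Carrier) → (∀ d → n < d → d ≤ n ℕ.+ t → f d ≈ ε) → fold (n ℕ.+ t) f ≈ fold n f
  fold-extend n t f f≈ε = begin
    fold (n ℕ.+ t) f                             ≈⟨ fold-+ n t f ⟩
    fold n f ∙ fold t (λ i → f (n ℕ.+ i))        ≈⟨ ∙-cong Mon.refl (fold-ε t _ λ i (1≤i , i≤t) → f≈ε (n ℕ.+ i) (ℕ.m<m+n n 1≤i) (ℕ.+-monoʳ-≤ n i≤t)) ⟩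
    fold n f ∙ ε                                 ≈⟨ identityʳ _ ⟩
    fold n f                                     ∎

  fold-single : ∀ n (f : ℕ → Carrier) q → InRange n q → (∀ d → InRange n d → d ≢ q → f d ≈ ε) → fold n f ≈ f q
  fold-single zero    f q (1≤q , q≤0) _ = ⊥-elim (ℕ.<⇒≱ 1≤q q≤0)
  fold-single (suc n) f q (1≤q , q≤1+n) f≈ε with ℕ.m≤n⇒m<n∨m≡n q≤1+n
  ... | inj₁ q<1+n = begin
    fold n f ∙ f (suc n)   ≈⟨ ∙-cong (fold-single n f q (1≤q , ℕ.≤-pred q<1+n) (λ d → f≈ε d ∘ InRange-suc))
                                     (f≈ε (suc n) (InRange-top n) (ℕ.<⇒≢ q<1+n ∘ ≡.sym)) ⟩
    f q ∙ ε                ≈⟨ identityʳ (f q) ⟩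
    f q                    ∎
  ... | inj₂ ≡.refl = begin
    fold n f ∙ f (suc n)   ≈⟨ ∙-cong (fold-ε n f λ d d∈n → f≈ε d (InRange-suc d∈n) (ℕ.<⇒≢ (s≤s (proj₂ d∈n)))) Mon.refl ⟩
    ε ∙ f (suc n)          ≈⟨ identityˡ _ ⟩
    f (suc n)              ∎

  fold-reindex : ∀ d e (f : ℕ → Carrier) → 1 ≤ e → (∀ k → ¬ e ∣ k → f k ≈ ε) → fold (d ℕ.* e) f ≈ fold d (λ j → f (j ℕ.* e))
  fold-reindex zero    e f _ _ = Mon.refl
  fold-reindex (suc d) e f 1≤e f≈ε = begin
    fold (e ℕ.+ d ℕ.* e) f                               ≡⟨ ≡.cong (λ n → fold n f) (ℕ.+-comm e (d ℕ.* e)) ⟩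
    fold (d ℕ.* e ℕ.+ e) f                               ≈⟨ fold-+ (d ℕ.* e) e f ⟩
    fold (d ℕ.* e) f ∙ fold e (λ i → f (d ℕ.* e ℕ.+ i))  ≈⟨ ∙-cong (fold-reindex d e f 1≤e f≈ε) (fold-single e _ e (1≤e , ℕ.≤-refl) off-multiples) ⟩
    fold d (λ j → f (j ℕ.* e)) ∙ f (d ℕ.* e ℕ.+ e)       ≡⟨ ≡.cong (λ n → fold d (λ j → f (j ℕ.* e)) ∙ f n) (ℕ.+-comm (d ℕ.* e) e) ⟩
    fold (suc d) (λ j → f (j ℕ.* e))                     ∎
    where
    off-multiples : ∀ i → InRange e i → i ≢ e → f (d ℕ.* e ℕ.+ i) ≈ ε
    off-multiples i (1≤i , i≤e) i≢e = f≈ε _ λ e∣de+i →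
      ℕ.<⇒≱ (ℕ.≤∧≢⇒< i≤e i≢e) (∣⇒≤ {{ℕ.>-nonZero 1≤i}} (∣m+n∣m⇒∣n e∣de+i (n∣m*n d)))

  fold-swap : ∀ n m (F : ℕ → ℕ → Carrier) → fold n (λ k → fold m (F k)) ≈ fold m (λ d → fold n (λ k → F k d))
  fold-swap zero    m F = Mon.sym (fold-ε m _ λ _ _ → Mon.refl)
  fold-swap (suc n) m F = Mon.trans (∙-cong (fold-swap n m F) Mon.refl) (Mon.sym (fold-∙ m _ _))

-- The ring of integer polynomials

infix 4 _≈_
record _≈_ (f g : Poly) : Set where
  constructor mk≈
  field coeff-≈ : ∀ k → coeff f k ≡ coeff g k
open _≈_ public

≈-refl : ∀ {f} → f ≈ f
≈-refl = mk≈ λ _ → refl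

≈-sym : ∀ {f g} → f ≈ g → g ≈ f
≈-sym f≈g = mk≈ λ k → sym (coeff-≈ f≈g k)

≈-trans : ∀ {f g h} → f ≈ g → g ≈ h → f ≈ h
≈-trans f≈g g≈h = mk≈ λ k → trans (coeff-≈ f≈g k) (coeff-≈ g≈h k)

≈-reflexive : ∀ {f g} → f ≡ g → f ≈ g
≈-reflexive refl = ≈-refl

≈-isEquivalence : IsEquivalence _≈_
≈-isEquivalence = record { refl = ≈-refl ; sym = ≈-sym ; trans = ≈-trans }

negP : Poly → Poly
negP = map (λ a → - a)

scaleP : ℤ → Poly → Poly
scaleP a = map (a *_)

shiftP : Poly → Poly
shiftP f = 0ℤ ∷ f

constP : ℤ → Poly
constP c = [ c ]

oneP : Poly
oneP = constP 1ℤ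

coeff-addP : ∀ f g k → coeff (addP f g) k ≡ coeff f k + coeff g k
coeff-addP []      g       k       = sym (ℤ.+-identityˡ _)
coeff-addP (a ∷ f) []      k       = sym (ℤ.+-identityʳ _)
coeff-addP (a ∷ f) (b ∷ g) zero    = refl
coeff-addP (a ∷ f) (b ∷ g) (suc k) = coeff-addP f g k

coeff-map : ∀ (h : ℤ → ℤ) → h 0ℤ ≡ 0ℤ → ∀ f k → coeff (map h f) k ≡ h (coeff f k)
coeff-map h h0 []      k       = sym h0
coeff-map h h0 (a ∷ f) zero    = refl
coeff-map h h0 (a ∷ f) (suc k) = coeff-map h h0 f k

coeff-scaleP : ∀ a f k → coeff (scaleP a f) k ≡ a * coeff f k
coeff-scaleP a = coeff-map (a *_) (ℤ.*-zeroʳ a)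

coeff-negP : ∀ f k → coeff (negP f) k ≡ - coeff f k
coeff-negP = coeff-map (λ a → - a) refl

sumBelow : ℕ → (ℕ → ℤ) → ℤ
sumBelow zero    h = 0ℤ
sumBelow (suc n) h = h 0 + sumBelow n (λ i → h (suc i))

sumBelow-cong : ∀ n {h h′ : ℕ → ℤ} → (∀ i → h i ≡ h′ i) → sumBelow n h ≡ sumBelow n h′
sumBelow-cong zero    eq = refl
sumBelow-cong (suc n) eq = cong₂ _+_ (eq 0) (sumBelow-cong n (λ i → eq (suc i)))

sumBelow-zero : ∀ n {h : ℕ → ℤ} → (∀ i → i < n → h i ≡ 0ℤ) → sumBelow n h ≡ 0ℤ
sumBelow-zero zero    h≡0 = refl
sumBelow-zero (suc n) h≡0 =
  cong₂ _+_ (h≡0 0 (s≤s z≤n)) (sumBelow-zero n (λ i i<n → h≡0 (suc i) (s≤s i<n)))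

sumBelow-single : ∀ n (h : ℕ → ℤ) j → j < n → (∀ i → i < n → i ≢ j → h i ≡ 0ℤ) → sumBelow n h ≡ h j
sumBelow-single (suc n) h zero    _         h≡0 =
  trans (cong (λ z → h 0 + z) (sumBelow-zero n (λ i i<n → h≡0 (suc i) (s≤s i<n) λ ()))) (ℤ.+-identityʳ (h 0))
sumBelow-single (suc n) h (suc j) (s≤s j<n) h≡0 =
  trans (cong₂ _+_ (h≡0 0 (s≤s z≤n) λ ())
                   (sumBelow-single n (h ∘ suc) j j<n λ i i<n i≢j → h≡0 (suc i) (s≤s i<n) (i≢j ∘ ℕ.suc-injective)))
        (ℤ.+-identityˡ (h (suc j)))

sumBelow-+ : ∀ n (h h′ : ℕ → ℤ) → sumBelow n (λ i → h i + h′ i) ≡ sumBelow n h + sumBelow n h′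
sumBelow-+ zero    h h′ = refl
sumBelow-+ (suc n) h h′ = begin
  (h 0 + h′ 0) + sumBelow n (λ i → h (suc i) + h′ (suc i))
    ≡⟨ cong (λ z → (h 0 + h′ 0) + z) (sumBelow-+ n _ _) ⟩
  (h 0 + h′ 0) + (sumBelow n _ + sumBelow n _)
    ≡⟨ solve 4 (λ a b c d → (a :+ b) :+ (c :+ d) := (a :+ c) :+ (b :+ d)) refl (h 0) (h′ 0) _ _ ⟩
  (h 0 + sumBelow n _) + (h′ 0 + sumBelow n _) ∎
  where open ≡-Reasoning

sumBelow-scale : ∀ n a (h : ℕ → ℤ) → sumBelow n (λ i → a * h i) ≡ a * sumBelow n h
sumBelow-scale zero    a h = sym (ℤ.*-zeroʳ a)
sumBelow-scale (suc n) a h =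
  trans (cong (λ z → a * h 0 + z) (sumBelow-scale n a _)) (sym (ℤ.*-distribˡ-+ a (h 0) _))

coeff-mulP : ∀ f g k → coeff (mulP f g) k ≡ sumBelow (suc k) (λ i → coeff f i * coeff g (k ∸ i))
coeff-mulP []      g k       = sym (sumBelow-zero (suc k) λ _ _ → refl)
coeff-mulP (a ∷ f) g zero    = trans (coeff-addP (scaleP a g) (shiftP (mulP f g)) 0) (cong (_+ 0ℤ) (coeff-scaleP a g 0))
coeff-mulP (a ∷ f) g (suc k) =
  trans (coeff-addP (scaleP a g) (shiftP (mulP f g)) (suc k)) (cong₂ _+_ (coeff-scaleP a g (suc k)) (coeff-mulP f g k))

coeff-mulP-zero : ∀ f g → coeff (mulP f g) 0 ≡ coeff f 0 * coeff g 0
coeff-mulP-zero f g = trans (coeff-mulP f g 0) (ℤ.+-identityʳ _)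

addP-cong : ∀ {f f′ g g′} → f ≈ f′ → g ≈ g′ → addP f g ≈ addP f′ g′
addP-cong {f} {f′} {g} {g′} f≈f′ g≈g′ = mk≈ λ k →
  trans (coeff-addP f g k) (trans (cong₂ _+_ (coeff-≈ f≈f′ k) (coeff-≈ g≈g′ k)) (sym (coeff-addP f′ g′ k)))

negP-cong : ∀ {f g} → f ≈ g → negP f ≈ negP g
negP-cong {f} {g} f≈g = mk≈ λ k →
  trans (coeff-negP f k) (trans (cong -_ (coeff-≈ f≈g k)) (sym (coeff-negP g k)))

shiftP-cong : ∀ {f g} → f ≈ g → shiftP f ≈ shiftP g
shiftP-cong f≈g = mk≈ λ { zero → refl ; (suc k) → coeff-≈ f≈g k }

mulP-cong : ∀ {f f′ g g′} → f ≈ f′ → g ≈ g′ → mulP f g ≈ mulP f′ g′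
mulP-cong {f} {f′} {g} {g′} f≈f′ g≈g′ = mk≈ λ k →
  trans (coeff-mulP f g k)
    (trans (sumBelow-cong (suc k) (λ i → cong₂ _*_ (coeff-≈ f≈f′ i) (coeff-≈ g≈g′ (k ∸ i))))
           (sym (coeff-mulP f′ g′ k)))

addP-comm : ∀ f g → addP f g ≈ addP g f
addP-comm f g = mk≈ λ k →
  trans (coeff-addP f g k) (trans (ℤ.+-comm (coeff f k) _) (sym (coeff-addP g f k)))

addP-assoc : ∀ f g h → addP (addP f g) h ≈ addP f (addP g h)
addP-assoc f g h = mk≈ λ k → begin
  coeff (addP (addP f g) h) k            ≡⟨ coeff-addP (addP f g) h k ⟩
  coeff (addP f g) k + coeff h k         ≡⟨ cong (_+ coeff h k) (coeff-addP f g k) ⟩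
  coeff f k + coeff g k + coeff h k      ≡⟨ ℤ.+-assoc (coeff f k) _ _ ⟩
  coeff f k + (coeff g k + coeff h k)    ≡⟨ cong (λ z → coeff f k + z) (coeff-addP g h k) ⟨
  coeff f k + coeff (addP g h) k         ≡⟨ coeff-addP f (addP g h) k ⟨
  coeff (addP f (addP g h)) k            ∎
  where open ≡-Reasoning

addP-identityˡ : ∀ f → addP [] f ≈ f
addP-identityˡ f = ≈-refl

addP-identityʳ : ∀ f → addP f [] ≈ f
addP-identityʳ []      = ≈-refl
addP-identityʳ (a ∷ f) = ≈-refl

addP-inverseˡ : ∀ f → addP (negP f) f ≈ []
addP-inverseˡ f = mk≈ λ k →
  trans (coeff-addP (negP f) f k) (trans (cong (_+ coeff f k) (coeff-negP f k)) (ℤ.+-inverseˡ (coeff f k)))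

addP-inverseʳ : ∀ f → addP f (negP f) ≈ []
addP-inverseʳ f = ≈-trans (addP-comm f (negP f)) (addP-inverseˡ f)

mulP-zeroʳ : ∀ f → mulP f [] ≈ []
mulP-zeroʳ f = mk≈ λ k → trans (coeff-mulP f [] k) (sumBelow-zero (suc k) λ i _ → ℤ.*-zeroʳ (coeff f i))

mulP-distribʳ : ∀ f h g → mulP (addP f h) g ≈ addP (mulP f g) (mulP h g)
mulP-distribʳ f h g = mk≈ λ k → begin
  coeff (mulP (addP f h) g) k
    ≡⟨ coeff-mulP (addP f h) g k ⟩
  sumBelow (suc k) (λ i → coeff (addP f h) i * coeff g (k ∸ i))
    ≡⟨ sumBelow-cong (suc k) (λ i → trans (cong (_* coeff g (k ∸ i)) (coeff-addP f h i))
                                          (ℤ.*-distribʳ-+ (coeff g (k ∸ i)) (coeff f i) (coeff h i))) ⟩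
  sumBelow (suc k) (λ i → coeff f i * coeff g (k ∸ i) + coeff h i * coeff g (k ∸ i))
    ≡⟨ sumBelow-+ (suc k) (λ i → coeff f i * coeff g (k ∸ i)) (λ i → coeff h i * coeff g (k ∸ i)) ⟩
  sumBelow (suc k) (λ i → coeff f i * coeff g (k ∸ i)) + sumBelow (suc k) (λ i → coeff h i * coeff g (k ∸ i))
    ≡⟨ cong₂ _+_ (coeff-mulP f g k) (coeff-mulP h g k) ⟨
  coeff (mulP f g) k + coeff (mulP h g) k
    ≡⟨ coeff-addP (mulP f g) (mulP h g) k ⟨
  coeff (addP (mulP f g) (mulP h g)) k ∎
  where open ≡-Reasoning

mulP-scaleˡ : ∀ a f g → mulP (scaleP a f) g ≈ scaleP a (mulP f g)
mulP-scaleˡ a f g = mk≈ λ k → begin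
  coeff (mulP (scaleP a f) g) k
    ≡⟨ coeff-mulP (scaleP a f) g k ⟩
  sumBelow (suc k) (λ i → coeff (scaleP a f) i * coeff g (k ∸ i))
    ≡⟨ sumBelow-cong (suc k) (λ i → trans (cong (_* coeff g (k ∸ i)) (coeff-scaleP a f i))
                                          (ℤ.*-assoc a (coeff f i) (coeff g (k ∸ i)))) ⟩
  sumBelow (suc k) (λ i → a * (coeff f i * coeff g (k ∸ i)))
    ≡⟨ sumBelow-scale (suc k) a (λ i → coeff f i * coeff g (k ∸ i)) ⟩
  a * sumBelow (suc k) (λ i → coeff f i * coeff g (k ∸ i))
    ≡⟨ cong (a *_) (coeff-mulP f g k) ⟨
  a * coeff (mulP f g) k
    ≡⟨ coeff-scaleP a (mulP f g) k ⟨
  coeff (scaleP a (mulP f g)) k ∎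
  where open ≡-Reasoning

mulP-shiftˡ : ∀ f g → mulP (shiftP f) g ≈ shiftP (mulP f g)
mulP-shiftˡ f g = mk≈ λ k → begin
  coeff (addP (scaleP 0ℤ g) (shiftP (mulP f g))) k     ≡⟨ coeff-addP (scaleP 0ℤ g) _ k ⟩
  coeff (scaleP 0ℤ g) k + coeff (shiftP (mulP f g)) k  ≡⟨ cong (_+ coeff (shiftP (mulP f g)) k) (coeff-scaleP 0ℤ g k) ⟩
  0ℤ * coeff g k + coeff (shiftP (mulP f g)) k         ≡⟨ ℤ.+-identityˡ _ ⟩
  coeff (shiftP (mulP f g)) k                          ∎
  where open ≡-Reasoning

mulP-consʳ : ∀ f b g → mulP f (b ∷ g) ≈ addP (scaleP b f) (shiftP (mulP f g))
mulP-consʳ []      b g = mk≈ λ { zero → refl ; (suc k) → refl }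
mulP-consʳ (a ∷ f) b g = mk≈ λ
  { zero    → cong (_+ 0ℤ) (ℤ.*-comm a b)
  ; (suc k) → begin
      coeff (addP (scaleP a g) (mulP f (b ∷ g))) k
        ≡⟨ trans (coeff-addP (scaleP a g) _ k) (cong (_+ _) (coeff-scaleP a g k)) ⟩
      a * coeff g k + coeff (mulP f (b ∷ g)) k
        ≡⟨ cong (λ z → a * coeff g k + z) (coeff-≈ (mulP-consʳ f b g) k) ⟩
      a * coeff g k + coeff (addP (scaleP b f) (shiftP (mulP f g))) k
        ≡⟨ cong (λ z → a * coeff g k + z) (trans (coeff-addP (scaleP b f) _ k) (cong (_+ _) (coeff-scaleP b f k))) ⟩
      a * coeff g k + (b * coeff f k + coeff (shiftP (mulP f g)) k)
        ≡⟨ solve 3 (λ x y z → x :+ (y :+ z) := y :+ (x :+ z)) refl (a * coeff g k) (b * coeff f k) _ ⟩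
      b * coeff f k + (a * coeff g k + coeff (shiftP (mulP f g)) k)
        ≡⟨ cong₂ _+_ (coeff-scaleP b f k) (trans (coeff-addP (scaleP a g) _ k) (cong (_+ _) (coeff-scaleP a g k))) ⟨
      coeff (scaleP b f) k + coeff (mulP (a ∷ f) g) k
        ≡⟨ coeff-addP (scaleP b f) (mulP (a ∷ f) g) k ⟨
      coeff (addP (scaleP b (a ∷ f)) (shiftP (mulP (a ∷ f) g))) (suc k) ∎ }
  where open ≡-Reasoning

mulP-comm : ∀ f g → mulP f g ≈ mulP g f
mulP-comm []      g = ≈-sym (mulP-zeroʳ g)
mulP-comm (a ∷ f) g = ≈-trans (addP-cong (≈-refl {scaleP a g}) (shiftP-cong (mulP-comm f g))) (≈-sym (mulP-consʳ g a f))

mulP-assoc : ∀ f g h → mulP (mulP f g) h ≈ mulP f (mulP g h)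
mulP-assoc []      g h = ≈-refl
mulP-assoc (a ∷ f) g h =
  ≈-trans (mulP-distribʳ (scaleP a g) (shiftP (mulP f g)) h)
          (addP-cong (mulP-scaleˡ a g h) (≈-trans (mulP-shiftˡ (mulP f g) h) (shiftP-cong (mulP-assoc f g h))))

mulP-distribˡ : ∀ f g h → mulP f (addP g h) ≈ addP (mulP f g) (mulP f h)
mulP-distribˡ f g h =
  ≈-trans (mulP-comm f (addP g h)) (≈-trans (mulP-distribʳ g h f) (addP-cong (mulP-comm g f) (mulP-comm h f)))

mulP-constˡ : ∀ c f → mulP (constP c) f ≈ scaleP c f
mulP-constˡ c f = mk≈ λ k →
  trans (coeff-addP (scaleP c f) (shiftP []) k) (trans (cong (λ z → coeff (scaleP c f) k + z) (zero-coeff k)) (ℤ.+-identityʳ _))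
  where
  zero-coeff : ∀ k → coeff (shiftP []) k ≡ 0ℤ
  zero-coeff zero    = refl
  zero-coeff (suc k) = refl

mulP-identityˡ : ∀ f → mulP oneP f ≈ f
mulP-identityˡ f = ≈-trans (mulP-constˡ 1ℤ f) (mk≈ λ k → trans (coeff-scaleP 1ℤ f k) (ℤ.*-identityˡ _))

mulP-identityʳ : ∀ f → mulP f oneP ≈ f
mulP-identityʳ f = ≈-trans (mulP-comm f oneP) (mulP-identityˡ f)

polyCommutativeRing : CommutativeRing _ _
polyCommutativeRing = record
  { Carrier = Poly ; _≈_ = _≈_ ; _+_ = addP ; _*_ = mulP ; -_ = negP ; 0# = [] ; 1# = oneP
  ; isCommutativeRing = record
    { isRing = record
      { +-isAbelianGroup = record
        { isGroup = record
          { isMonoid = record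
            { isSemigroup = record
              { isMagma = record { isEquivalence = ≈-isEquivalence ; ∙-cong = addP-cong }
              ; assoc = addP-assoc }
            ; identity = addP-identityˡ , addP-identityʳ }
          ; inverse = addP-inverseˡ , addP-inverseʳ
          ; ⁻¹-cong = negP-cong }
        ; comm = addP-comm }
      ; *-cong = mulP-cong
      ; *-assoc = mulP-assoc
      ; *-identity = mulP-identityˡ , mulP-identityʳ
      ; distrib = mulP-distribˡ , (λ g f h → mulP-distribʳ f h g) }
    ; *-comm = mulP-comm } }

isZeroPoly? : (f : Poly) → Maybe ([] ≈ f)
isZeroPoly? []      = just ≈-refl
isZeroPoly? (a ∷ f) with a ℤ.≟ 0ℤ | isZeroPoly? f
... | yes a≡0 | just f≈0 = just (mk≈ λ { zero → sym a≡0 ; (suc k) → coeff-≈ f≈0 k })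
... | _       | _        = nothing

open import Tactic.RingSolver.NonReflective (ACR.fromCommutativeRing polyCommutativeRing isZeroPoly?)
  using (_⊜_; _⊕_; _⊗_; ⊝_; Κ) renaming (solve to solveP)

module ≈-Reasoning = Relation.Binary.Reasoning.Setoid (CommutativeRing.setoid polyCommutativeRing)

*-≢0 : ∀ {a b} → a ≢ 0ℤ → b ≢ 0ℤ → a * b ≢ 0ℤ
*-≢0 {a} a≢0 b≢0 ab≡0 = [ a≢0 , b≢0 ]′ (ℤ.i*j≡0⇒i≡0∨j≡0 a ab≡0)

+-<⇒<∸ : ∀ X {b k} → X ℕ.+ b < k → b < k ∸ X
+-<⇒<∸ X {b} X+b<k = subst (_< _ ∸ X) (ℕ.m+n∸m≡n X b) (ℕ.∸-monoˡ-< X+b<k (ℕ.m≤m+n X b))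

<+⇒∸< : ∀ {X k b} → X ≤ k → k < X ℕ.+ b → k ∸ X < b
<+⇒∸< {X} {k} {b} X≤k k<X+b = ℕ.+-cancelˡ-< X (k ∸ X) b (subst (_< X ℕ.+ b) (sym (ℕ.m+[n∸m]≡n X≤k)) k<X+b)

*-≡0ˡ : ∀ {a} b → a ≡ 0ℤ → a * b ≡ 0ℤ
*-≡0ˡ b refl = ℤ.*-zeroˡ b

*-≡0ʳ : ∀ a {b} → b ≡ 0ℤ → a * b ≡ 0ℤ
*-≡0ʳ a refl = ℤ.*-zeroʳ a

DegreeAtMost : Poly → ℕ → Set
DegreeAtMost f n = ∀ k → n < k → coeff f k ≡ 0ℤ

DegreeAtMost-mono : ∀ f {m n} → m ≤ n → DegreeAtMost f m → DegreeAtMost f n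
DegreeAtMost-mono f m≤n deg≤m k n<k = deg≤m k (ℕ.≤-<-trans m≤n n<k)

coeff-≥length : ∀ f k → length f ≤ k → coeff f k ≡ 0ℤ
coeff-≥length []      k       _           = refl
coeff-≥length (a ∷ f) (suc k) (s≤s len≤k) = coeff-≥length f k len≤k

DegreeAtMost-resp-≈ : ∀ {f g} n → f ≈ g → DegreeAtMost f n → DegreeAtMost g n
DegreeAtMost-resp-≈ n f≈g deg≤n k n<k = trans (sym (coeff-≈ f≈g k)) (deg≤n k n<k)

IsDeg-resp-≈ : ∀ {f g} n → f ≈ g → IsDeg f n → IsDeg g n
IsDeg-resp-≈ n f≈g (fₙ≢0 , deg≤n) = (λ gₙ≡0 → fₙ≢0 (trans (coeff-≈ f≈g n) gₙ≡0)) , DegreeAtMost-resp-≈ n f≈g deg≤n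

IsDeg-unique : ∀ f {a b} → IsDeg f a → IsDeg f b → a ≡ b
IsDeg-unique f {a} {b} (fₐ≢0 , deg≤a) (f_b≢0 , deg≤b) with ℕ.<-cmp a b
... | tri< a<b _ _ = ⊥-elim (f_b≢0 (deg≤a b a<b))
... | tri≈ _ a≡b _ = a≡b
... | tri> _ _ b<a = ⊥-elim (fₐ≢0 (deg≤b a b<a))

≈0⊎IsDeg : ∀ f → (f ≈ []) ⊎ (Σ ℕ λ d → IsDeg f d)
≈0⊎IsDeg []      = inj₁ ≈-refl
≈0⊎IsDeg (a ∷ f) with ≈0⊎IsDeg f
... | inj₂ (d , f_d≢0 , deg≤d) = inj₂ (suc d , f_d≢0 , λ { (suc k) (s≤s d<k) → deg≤d k d<k })
... | inj₁ f≈0 with a ℤ.≟ 0ℤ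
...   | yes a≡0 = inj₁ (mk≈ λ { zero → a≡0 ; (suc k) → coeff-≈ f≈0 k })
...   | no  a≢0 = inj₂ (0 , a≢0 , λ { (suc k) _ → coeff-≈ f≈0 k })

coeff-mulP-single : ∀ f g n j → j ≤ n → (∀ i → i ≤ n → i ≢ j → coeff f i * coeff g (n ∸ i) ≡ 0ℤ) →
                    coeff (mulP f g) n ≡ coeff f j * coeff g (n ∸ j)
coeff-mulP-single f g n j j≤n others =
  trans (coeff-mulP f g n) (sumBelow-single (suc n) _ j (s≤s j≤n) λ i i<1+n → others i (ℕ.≤-pred i<1+n))

coeff-mulP-top : ∀ f g a b → DegreeAtMost f a → DegreeAtMost g b → coeff (mulP f g) (a ℕ.+ b) ≡ coeff f a * coeff g b
coeff-mulP-top f g a b deg≤a deg≤b =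
  trans (coeff-mulP-single f g (a ℕ.+ b) a (ℕ.m≤m+n a b) others) (cong (λ t → coeff f a * coeff g t) (ℕ.m+n∸m≡n a b))
  where
  others : ∀ i → i ≤ a ℕ.+ b → i ≢ a → coeff f i * coeff g (a ℕ.+ b ∸ i) ≡ 0ℤ
  others i _ i≢a with ℕ.<-cmp i a
  ... | tri≈ _ i≡a _ = ⊥-elim (i≢a i≡a)
  ... | tri> _ _ a<i = *-≡0ˡ _ (deg≤a i a<i)
  ... | tri< i<a _ _ = *-≡0ʳ (coeff f i) (deg≤b _ (+-<⇒<∸ i (ℕ.+-monoˡ-< b i<a)))

mulP-DegreeAtMost : ∀ f g a b → DegreeAtMost f a → DegreeAtMost g b → DegreeAtMost (mulP f g) (a ℕ.+ b)
mulP-DegreeAtMost f g a b deg≤a deg≤b k a+b<k = trans (coeff-mulP f g k) (sumBelow-zero (suc k) term≡0)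
  where
  term≡0 : ∀ i → i < suc k → coeff f i * coeff g (k ∸ i) ≡ 0ℤ
  term≡0 i _ with a ℕ.<? i
  ... | yes a<i = *-≡0ˡ _ (deg≤a i a<i)
  ... | no  a≮i = *-≡0ʳ (coeff f i) (deg≤b (k ∸ i) (+-<⇒<∸ i (ℕ.≤-<-trans (ℕ.+-monoˡ-≤ b (ℕ.≮⇒≥ a≮i)) a+b<k)))

mulP-IsDeg : ∀ f g a b → IsDeg f a → IsDeg g b → IsDeg (mulP f g) (a ℕ.+ b)
mulP-IsDeg f g a b (fₐ≢0 , deg≤a) (g_b≢0 , deg≤b) =
  (λ top≡0 → *-≢0 fₐ≢0 g_b≢0 (trans (sym (coeff-mulP-top f g a b deg≤a deg≤b)) top≡0)) ,
  mulP-DegreeAtMost f g a b deg≤a deg≤b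

quotient-DegreeAtMost : ∀ D Q P e n → IsDeg D e → mulP D Q ≈ P → DegreeAtMost P (e ℕ.+ n) → DegreeAtMost Q n
quotient-DegreeAtMost D Q P e n degD DQ≈P deg≤e+n with ≈0⊎IsDeg Q
... | inj₁ Q≈0        = λ k _ → coeff-≈ Q≈0 k
... | inj₂ (d , degQ) = DegreeAtMost-mono Q (ℕ.≮⇒≥ n≮d) (proj₂ degQ)
  where
  n≮d : ¬ n < d
  n≮d n<d = proj₁ (IsDeg-resp-≈ (e ℕ.+ d) DQ≈P (mulP-IsDeg D Q e d degD degQ)) (deg≤e+n (e ℕ.+ d) (ℕ.+-monoʳ-< e n<d))

mulP-consˡ-coeff : ∀ d D C k → coeff (mulP (d ∷ D) C) k ≡ d * coeff C k + coeff (shiftP (mulP D C)) k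
mulP-consˡ-coeff d D C k = trans (coeff-addP (scaleP d C) (shiftP (mulP D C)) k) (cong (_+ _) (coeff-scaleP d C k))

mulP-≈0-cancelʳ : ∀ D C → coeff C 0 ≢ 0ℤ → mulP D C ≈ [] → D ≈ []
mulP-≈0-cancelʳ []      C C₀≢0 DC≈0 = ≈-refl
mulP-≈0-cancelʳ (d ∷ D) C C₀≢0 DC≈0 = mk≈ λ { zero → d≡0 ; (suc k) → coeff-≈ D≈0 k }
  where
  d≡0 : d ≡ 0ℤ
  d≡0 = [ id , (λ C₀≡0 → ⊥-elim (C₀≢0 C₀≡0)) ]′
          (ℤ.i*j≡0⇒i≡0∨j≡0 d (trans (sym (ℤ.+-identityʳ _)) (trans (sym (mulP-consˡ-coeff d D C 0)) (coeff-≈ DC≈0 0))))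
  D≈0 : D ≈ []
  D≈0 = mulP-≈0-cancelʳ D C C₀≢0 (mk≈ λ k → begin
    coeff (mulP D C) k                            ≡⟨ ℤ.+-identityˡ _ ⟨
    0ℤ + coeff (mulP D C) k                       ≡⟨ cong (λ z → z * coeff C (suc k) + coeff (mulP D C) k) d≡0 ⟨
    d * coeff C (suc k) + coeff (mulP D C) k      ≡⟨ mulP-consˡ-coeff d D C (suc k) ⟨
    coeff (mulP (d ∷ D) C) (suc k)                ≡⟨ coeff-≈ DC≈0 (suc k) ⟩
    0ℤ                                            ∎)
    where open ≡-Reasoning

mulP-cancelˡ : ∀ C A B → coeff C 0 ≢ 0ℤ → mulP C A ≈ mulP C B → A ≈ B
mulP-cancelˡ C A B C₀≢0 CA≈CB = mk≈ λ k → ℤ.i-j≡0⇒i≡j _ _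
  (trans (cong (λ z → coeff A k + z) (sym (coeff-negP B k)))
         (trans (sym (coeff-addP A (negP B) k)) (coeff-≈ A-B≈0 k)))
  where
  A-B≈0 : addP A (negP B) ≈ []
  A-B≈0 = mulP-≈0-cancelʳ (addP A (negP B)) C C₀≢0
    (≈-trans (solveP 3 (λ c a b → ((a ⊕ (⊝ b)) ⊗ c) ⊜ ((c ⊗ a) ⊕ (⊝ (c ⊗ b)))) ≈-refl C A B)
    (≈-trans (addP-cong CA≈CB (≈-refl {negP (mulP C B)})) (addP-inverseʳ (mulP C B))))

-- The recursions local to divExact and prodDivisors cannot be named outside Defs;
-- these metavariables are solved by unification (in the reveal-… terms) to exactly
-- those local functions, so that divExact≡loop and prodDivisors≡loop hold by refl.
private
  record Reveal (P : Poly) : Set where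
    constructor reveal

mutual
  divExactLoop : Poly → Poly → ℕ → List ℤ
  divExactLoop = _

  divisorsLoop : ℕ → List Poly → ℕ → List Poly → Poly
  divisorsLoop = _

  private
    reveal-divExact : ∀ P D → Reveal (divExact P D)
    reveal-divExact P D with length P
    ... | n with reverse {A = ℤ}
    ...   | r = revealed r n
      where
      revealed : ∀ (r : List ℤ → List ℤ) n → Reveal (r (divExactLoop P D n))
      revealed r n = reveal

    reveal-prodDivisors : ∀ N f fs → Reveal (prodDivisors N (f ∷ fs))
    reveal-prodDivisors N f fs with 1 ∣? N
    ... | no  _ = reveal
    ... | yes _ with f ∷ fs | 2
    ...   | L | d = revealed L d
      where
      revealed : ∀ L d → Reveal (mulP f (divisorsLoop N L d fs))
      revealed L d = reveal

divExact≡loop : ∀ P D → divExact P D ≡ reverse (divExactLoop P D (length P))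
divExact≡loop P D = refl

prodDivisors≡loop : ∀ N L → prodDivisors N L ≡ divisorsLoop N L 1 L
prodDivisors≡loop N L = refl

UnitConstant : Poly → Set
UnitConstant f = coeff f 0 * coeff f 0 ≡ 1ℤ

coeff-mulP≡dot : ∀ D Q k → coeff (mulP D Q) k ≡ dot D (applyDownFrom (coeff Q) (suc k))
coeff-mulP≡dot []      Q k       = refl
coeff-mulP≡dot (a ∷ D) Q zero    = trans (mulP-consˡ-coeff a D Q 0) (cong (λ z → a * coeff Q 0 + z) (dot-[] D))
  where
  dot-[] : ∀ D → 0ℤ ≡ dot D []
  dot-[] []      = refl
  dot-[] (_ ∷ _) = refl
coeff-mulP≡dot (a ∷ D) Q (suc k) = trans (mulP-consˡ-coeff a D Q (suc k)) (cong (λ z → a * coeff Q (suc k) + z) (coeff-mulP≡dot D Q k))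

divExactLoop-correct : ∀ P D Q → UnitConstant D → mulP D Q ≈ P → ∀ n → divExactLoop P D n ≡ applyDownFrom (coeff Q) n
divExactLoop-correct P D       Q u DQ≈P zero    = refl
divExactLoop-correct P (d ∷ D) Q u DQ≈P (suc n) = cong₂ _∷_ qₙ-correct ih
  where
  ih = divExactLoop-correct P (d ∷ D) Q u DQ≈P n
  s = dot D (applyDownFrom (coeff Q) n)
  qₙ-correct : d * (coeff P n - dot D (divExactLoop P (d ∷ D) n)) ≡ coeff Q n
  qₙ-correct = begin
    d * (coeff P n - dot D (divExactLoop P (d ∷ D) n))
      ≡⟨ cong₂ (λ a b → d * (a - dot D b)) (trans (sym (coeff-≈ DQ≈P n)) (coeff-mulP≡dot (d ∷ D) Q n)) ih ⟩
    d * ((d * coeff Q n + s) - s)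
      ≡⟨ solve 3 (λ x q t → x :* ((x :* q :+ t) :- t) := (x :* x) :* q) refl d (coeff Q n) s ⟩
    (d * d) * coeff Q n
      ≡⟨ trans (cong (_* coeff Q n) u) (ℤ.*-identityˡ (coeff Q n)) ⟩
    coeff Q n ∎
    where open ≡-Reasoning

coeff-applyUpTo< : ∀ (f : ℕ → ℤ) n k → k < n → coeff (applyUpTo f n) k ≡ f k
coeff-applyUpTo< f (suc n) zero    _         = refl
coeff-applyUpTo< f (suc n) (suc k) (s≤s k<n) = coeff-applyUpTo< (f ∘ suc) n k k<n

coeff-applyUpTo≥ : ∀ (f : ℕ → ℤ) n k → n ≤ k → coeff (applyUpTo f n) k ≡ 0ℤ
coeff-applyUpTo≥ f zero    k       _         = refl
coeff-applyUpTo≥ f (suc n) (suc k) (s≤s n≤k) = coeff-applyUpTo≥ (f ∘ suc) n k n≤k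

divExact-correct : ∀ P D Q → UnitConstant D → mulP D Q ≈ P → (∀ k → length P ≤ k → coeff Q k ≡ 0ℤ) → divExact P D ≈ Q
divExact-correct P D Q u DQ≈P Q-vanishes = mk≈ λ k → begin
  coeff (divExact P D) k
    ≡⟨ cong (λ l → coeff l k) (divExact≡loop P D) ⟩
  coeff (reverse (divExactLoop P D (length P))) k
    ≡⟨ cong (λ l → coeff (reverse l) k) (divExactLoop-correct P D Q u DQ≈P (length P)) ⟩
  coeff (reverse (applyDownFrom (coeff Q) (length P))) k
    ≡⟨ cong (λ l → coeff l k) (reverse-applyDownFrom (coeff Q) (length P)) ⟩
  coeff (applyUpTo (coeff Q) (length P)) k
    ≡⟨ truncation k ⟩
  coeff Q k ∎
  where
  open ≡-Reasoning
  truncation : ∀ k → coeff (applyUpTo (coeff Q) (length P)) k ≡ coeff Q k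
  truncation k with k ℕ.<? length P
  ... | yes k<len = coeff-applyUpTo< (coeff Q) (length P) k k<len
  ... | no  k≮len = trans (coeff-applyUpTo≥ (coeff Q) (length P) k (ℕ.≮⇒≥ k≮len)) (sym (Q-vanishes k (ℕ.≮⇒≥ k≮len)))

mono : ℕ → Poly
mono n = replicate n 0ℤ ++ [ 1ℤ ]

x^_−1 : ℕ → Poly
x^ n −1 = addP (mono n) (constP (- 1ℤ))

mono-+ : ∀ a b → mulP (mono a) (mono b) ≈ mono (a ℕ.+ b)
mono-+ zero    b = mulP-identityˡ (mono b)
mono-+ (suc a) b = ≈-trans (mulP-shiftˡ (mono a) (mono b)) (shiftP-cong (mono-+ a b))

coeff-mono-self : ∀ n → coeff (mono n) n ≡ 1ℤ
coeff-mono-self zero    = refl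
coeff-mono-self (suc n) = coeff-mono-self n

coeff-mono-other : ∀ n k → k ≢ n → coeff (mono n) k ≡ 0ℤ
coeff-mono-other zero    zero    k≢n = ⊥-elim (k≢n refl)
coeff-mono-other zero    (suc k) _   = refl
coeff-mono-other (suc n) zero    _   = refl
coeff-mono-other (suc n) (suc k) k≢n = coeff-mono-other n k (k≢n ∘ cong suc)

xPowMinusOne≈x^−1 : ∀ n → xPowMinusOne n ≈ x^ n −1
xPowMinusOne≈x^−1 zero    = mk≈ λ { zero → refl ; (suc k) → refl }
xPowMinusOne≈x^−1 (suc n) = mk≈ λ { zero → refl ; (suc k) → sym (trans (coeff-addP (mono n) [] k) (ℤ.+-identityʳ _)) }

x^0−1≈0 : x^ 0 −1 ≈ []
x^0−1≈0 = mk≈ λ { zero → refl ; (suc k) → refl }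

x^−1-IsDeg : ∀ n → 1 ≤ n → IsDeg (x^ n −1) n
x^−1-IsDeg (suc n) _ = top≢0 , above
  where
  top≢0 : coeff (x^ suc n −1) (suc n) ≢ 0ℤ
  top≢0 top≡0 with () ← trans (sym (trans (coeff-addP (mono n) [] n) (trans (ℤ.+-identityʳ _) (coeff-mono-self n)))) top≡0
  above : DegreeAtMost (x^ suc n −1) (suc n)
  above (suc k) (s≤s n<k) = trans (coeff-addP (mono n) [] k) (trans (ℤ.+-identityʳ _) (coeff-mono-other n k (ℕ.<⇒≢ n<k ∘ sym)))

coeff-x^−1-zero : ∀ n → 1 ≤ n → coeff (x^ n −1) 0 ≢ 0ℤ
coeff-x^−1-zero (suc n) _ ()

x^−1-+ : ∀ d n → x^ (d ℕ.+ n) −1 ≈ addP (mulP (mono d) (x^ n −1)) (x^ d −1)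
x^−1-+ d n = ≈-trans (addP-cong (≈-sym (mono-+ d n)) (≈-refl {constP (- 1ℤ)}))
  (solveP 2 (λ D N → ((D ⊗ N) ⊕ (⊝ Κ oneP)) ⊜ ((D ⊗ (N ⊕ (⊝ Κ oneP))) ⊕ (D ⊕ (⊝ Κ oneP)))) ≈-refl (mono d) (mono n))

geomSum : ℕ → ℕ → Poly
geomSum g zero    = []
geomSum g (suc k) = addP (geomSum g k) (mono (k ℕ.* g))

x^−1*geomSum : ∀ g k → mulP (x^ g −1) (geomSum g k) ≈ x^ (k ℕ.* g) −1
x^−1*geomSum g zero    = ≈-trans (mulP-zeroʳ (x^ g −1)) (≈-sym x^0−1≈0)
x^−1*geomSum g (suc k) = begin
  mulP (x^ g −1) (addP (geomSum g k) (mono (k ℕ.* g)))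
    ≈⟨ mulP-distribˡ (x^ g −1) (geomSum g k) (mono (k ℕ.* g)) ⟩
  addP (mulP (x^ g −1) (geomSum g k)) (mulP (x^ g −1) (mono (k ℕ.* g)))
    ≈⟨ addP-cong (x^−1*geomSum g k) (mulP-comm (x^ g −1) (mono (k ℕ.* g))) ⟩
  addP (x^ (k ℕ.* g) −1) (mulP (mono (k ℕ.* g)) (x^ g −1))
    ≈⟨ addP-comm (x^ (k ℕ.* g) −1) _ ⟩
  addP (mulP (mono (k ℕ.* g)) (x^ g −1)) (x^ (k ℕ.* g) −1)
    ≈⟨ x^−1-+ (k ℕ.* g) g ⟨
  x^ (k ℕ.* g ℕ.+ g) −1
    ≡⟨ cong x^_−1 (ℕ.+-comm (k ℕ.* g) g) ⟩
  x^ (suc k ℕ.* g) −1 ∎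
  where open ≈-Reasoning

x^−1-∣ : ∀ {a b} → a ∣ b → Σ Poly λ Q → mulP (x^ a −1) Q ≈ x^ b −1
x^−1-∣ {a} (divides k refl) = geomSum a k , x^−1*geomSum a k

-- Every x ^ (i g) is 1 modulo x ^ g - 1.
geomSum-mod : ∀ g k → Σ Poly λ H → addP (geomSum g k) (negP (constP (+ k))) ≈ mulP (x^ g −1) H
geomSum-mod g zero    = [] , ≈-trans (mk≈ λ { zero → refl ; (suc k) → refl }) (≈-sym (mulP-zeroʳ (x^ g −1)))
geomSum-mod g (suc k) = addP H (geomSum g k) , (begin
  addP (addP (geomSum g k) (mono (k ℕ.* g))) (negP (constP (+ suc k)))
    ≈⟨ addP-cong (≈-refl {addP (geomSum g k) (mono (k ℕ.* g))}) (negP-cong 1+k≈k+1) ⟩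
  addP (addP (geomSum g k) (mono (k ℕ.* g))) (negP (addP (constP (+ k)) oneP))
    ≈⟨ solveP 3 (λ G M C → ((G ⊕ M) ⊕ (⊝ (C ⊕ Κ oneP))) ⊜ ((G ⊕ (⊝ C)) ⊕ (M ⊕ (⊝ Κ oneP)))) ≈-refl (geomSum g k) (mono (k ℕ.* g)) (constP (+ k)) ⟩
  addP (addP (geomSum g k) (negP (constP (+ k)))) (x^ (k ℕ.* g) −1)
    ≈⟨ addP-cong (proj₂ (geomSum-mod g k)) (≈-sym (x^−1*geomSum g k)) ⟩
  addP (mulP (x^ g −1) H) (mulP (x^ g −1) (geomSum g k))
    ≈⟨ mulP-distribˡ (x^ g −1) H (geomSum g k) ⟨
  mulP (x^ g −1) (addP H (geomSum g k)) ∎)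
  where
  open ≈-Reasoning
  H = proj₁ (geomSum-mod g k)
  1+k≈k+1 : constP (+ suc k) ≈ addP (constP (+ k)) oneP
  1+k≈k+1 = mk≈ λ { zero → cong +_ (ℕ.+-comm 1 k) ; (suc j) → refl }

BézoutCombination : ℕ → ℕ → ℕ → Set
BézoutCombination a b g = Σ Poly λ A → Σ Poly λ B → addP (mulP A (x^ a −1)) (mulP B (x^ b −1)) ≈ x^ g −1

BézoutCombination-sym : ∀ {a b g} → BézoutCombination a b g → BézoutCombination b a g
BézoutCombination-sym {a} {b} (A , B , eq) = B , A , ≈-trans (addP-comm (mulP B (x^ b −1)) (mulP A (x^ a −1))) eq

-- From g + y b = x a: x ^ (x a) - 1 = x ^ g (x ^ (y b) - 1) + (x ^ g - 1).
BézoutCombination-from-identity : ∀ {a b g} x y → g ℕ.+ y ℕ.* b ≡ x ℕ.* a → BézoutCombination a b g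
BézoutCombination-from-identity {a} {b} {g} x y g+yb≡xa = geomSum a x , negP (mulP (mono g) (geomSum b y)) , (begin
  addP (mulP (geomSum a x) (x^ a −1)) (mulP (negP (mulP (mono g) (geomSum b y))) (x^ b −1))
    ≈⟨ solveP 5 (λ A M B X Y → ((A ⊗ X) ⊕ ((⊝ (M ⊗ B)) ⊗ Y)) ⊜ ((X ⊗ A) ⊕ (⊝ (M ⊗ (Y ⊗ B)))))
                ≈-refl (geomSum a x) (mono g) (geomSum b y) (x^ a −1) (x^ b −1) ⟩
  addP (mulP (x^ a −1) (geomSum a x)) (negP (mulP (mono g) (mulP (x^ b −1) (geomSum b y))))
    ≈⟨ addP-cong (x^−1*geomSum a x) (negP-cong (mulP-cong (≈-refl {mono g}) (x^−1*geomSum b y))) ⟩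
  addP (x^ (x ℕ.* a) −1) (negP (mulP (mono g) (x^ (y ℕ.* b) −1)))
    ≡⟨ cong (λ n → addP (x^ n −1) (negP (mulP (mono g) (x^ (y ℕ.* b) −1)))) g+yb≡xa ⟨
  addP (x^ (g ℕ.+ y ℕ.* b) −1) (negP (mulP (mono g) (x^ (y ℕ.* b) −1)))
    ≈⟨ addP-cong (x^−1-+ g (y ℕ.* b)) ≈-refl ⟩
  addP (addP (mulP (mono g) (x^ (y ℕ.* b) −1)) (x^ g −1)) (negP (mulP (mono g) (x^ (y ℕ.* b) −1)))
    ≈⟨ solveP 2 (λ P G → ((P ⊕ G) ⊕ (⊝ P)) ⊜ G) ≈-refl (mulP (mono g) (x^ (y ℕ.* b) −1)) (x^ g −1) ⟩
  x^ g −1 ∎)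
  where open ≈-Reasoning

x^−1-Bézout : ∀ a b → Σ ℕ λ g → g ∣ a × g ∣ b × BézoutCombination a b g
x^−1-Bézout a b with Bézout.lemma a b
... | Bézout.result g gcd-g identity = g , proj₁ (GCD.commonDivisor gcd-g) , proj₂ (GCD.commonDivisor gcd-g) , combination identity
  where
  combination : Bézout.Identity g a b → BézoutCombination a b g
  combination (Bézout.+- x y eq) = BézoutCombination-from-identity {a} {b} {g} x y eq
  combination (Bézout.-+ x y eq) = BézoutCombination-sym {b} {a} {g} (BézoutCombination-from-identity {b} {a} {g} y x eq)

open RangeFold (CommutativeRing.*-commutativeMonoid polyCommutativeRing) using ()
  renaming (fold to prodTo; fold-cong to prodTo-cong; fold-∙ to prodTo-mulP;
            fold-extend to prodTo-extend; fold-reindex to prodTo-reindex)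

when : ∀ {A : Set} → Dec A → Poly → Poly
when (yes _) f = f
when (no  _) _ = oneP

when-yes : ∀ {A : Set} (a : Dec A) f → A → when a f ≡ f
when-yes (yes _) f _  = refl
when-yes (no ¬A) f A′ = ⊥-elim (¬A A′)

when-no : ∀ {A : Set} (a : Dec A) f → ¬ A → when a f ≡ oneP
when-no (yes A′) f ¬A = ⊥-elim (¬A A′)
when-no (no _)   f _  = refl

when-split : ∀ {A B C : Set} (a : Dec A) (b : Dec B) (c : Dec C) f →
             (A → B ⊎ C) → (B → A) → (C → A) → (B → ¬ C) → when a f ≈ mulP (when b f) (when c f)
when-split (yes A′) (yes B′) (yes C′) f _   _   _   B⇒¬C = ⊥-elim (B⇒¬C B′ C′)
when-split (yes _)  (yes _)  (no _)   f _   _   _   _    = ≈-sym (mulP-identityʳ f)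
when-split (yes _)  (no _)   (yes _)  f _   _   _   _    = ≈-sym (mulP-identityˡ f)
when-split (yes A′) (no ¬B)  (no ¬C)  f A⇒ _   _   _    = ⊥-elim ([ ¬B , ¬C ]′ (A⇒ A′))
when-split (no ¬A)  (yes B′) _        f _   B⇒A _   _    = ⊥-elim (¬A (B⇒A B′))
when-split (no ¬A)  (no _)   (yes C′) f _   _   C⇒A _    = ⊥-elim (¬A (C⇒A C′))
when-split (no _)   (no _)   (no _)   f _   _   _   _    = ≈-sym (mulP-identityˡ oneP)

onDivisorsOf : ℕ → (ℕ → Poly) → ℕ → Poly
onDivisorsOf N F d = when (d ∣? N) (F d)

onDivisorsOf-self : ∀ N F → onDivisorsOf N F N ≡ F N
onDivisorsOf-self N F = when-yes (N ∣? N) (F N) ∣-refl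

prodTo-onDivisorsOf-suc : ∀ n F → prodTo (suc n) (onDivisorsOf (suc n) F) ≈ mulP (prodTo n (onDivisorsOf (suc n) F)) (F (suc n))
prodTo-onDivisorsOf-suc n F = mulP-cong (≈-refl {prodTo n (onDivisorsOf (suc n) F)}) (≈-reflexive (onDivisorsOf-self (suc n) F))

prodTo-onDivisorsOf-beyond : ∀ N M F → 1 ≤ N → N ≤ M → prodTo M (onDivisorsOf N F) ≈ prodTo N (onDivisorsOf N F)
prodTo-onDivisorsOf-beyond N M F 1≤N N≤M =
  ≈-trans (≈-reflexive (cong (λ n → prodTo n (onDivisorsOf N F)) (sym (ℕ.m+[n∸m]≡n N≤M))))
          (prodTo-extend N (M ∸ N) (onDivisorsOf N F) λ d N<d _ →
            ≈-reflexive (when-no (d ∣? N) (F d) λ d∣N → ℕ.<⇒≱ N<d (∣⇒≤ {{ℕ.>-nonZero 1≤N}} d∣N)))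

divisorsLoop-snoc : ∀ N L d xs y → divisorsLoop N L d (xs ++ [ y ]) ≈ mulP (divisorsLoop N L d xs) (when ((d ℕ.+ length xs) ∣? N) y)
divisorsLoop-snoc N L d []       y rewrite ℕ.+-identityʳ d with d ∣? N
... | yes _ = mulP-comm y oneP
... | no  _ = ≈-sym (mulP-identityˡ oneP)
divisorsLoop-snoc N L d (x ∷ xs) y rewrite ℕ.+-suc d (length xs) with d ∣? N
... | yes _ = ≈-trans (mulP-cong (≈-refl {x}) (divisorsLoop-snoc N L (suc d) xs y)) (≈-sym (mulP-assoc x _ _))
... | no  _ = divisorsLoop-snoc N L (suc d) xs y

length-cycloTable : ∀ n → length (cycloTable n) ≡ n
length-cycloTable zero    = refl
length-cycloTable (suc n) = trans (length-++ (cycloTable n)) (trans (cong (ℕ._+ 1) (length-cycloTable n)) (ℕ.+-comm n 1))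

nth-++-length : ∀ (xs : List Poly) y → nth (xs ++ [ y ]) (length xs) ≡ y
nth-++-length []       y = refl
nth-++-length (x ∷ xs) y = nth-++-length xs y

Φ-suc : ∀ n → Φ (suc n) ≡ divExact (xPowMinusOne (suc n)) (prodDivisors (suc n) (cycloTable n))
Φ-suc n = subst (λ i → nth (cycloTable n ++ [ new ]) i ≡ new) (length-cycloTable n) (nth-++-length (cycloTable n) new)
  where new = divExact (xPowMinusOne (suc n)) (prodDivisors (suc n) (cycloTable n))

prodDivisors-cycloTable : ∀ N n → prodDivisors N (cycloTable n) ≈ prodTo n (onDivisorsOf N Φ)
prodDivisors-cycloTable N n = ≈-trans (≈-reflexive (prodDivisors≡loop N (cycloTable n))) (loop (cycloTable n) n)
  where
  loop : ∀ L n → divisorsLoop N L 1 (cycloTable n) ≈ prodTo n (onDivisorsOf N Φ)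
  loop L zero    = ≈-refl
  loop L (suc n) = begin
    divisorsLoop N L 1 (cycloTable n ++ [ _ ])
      ≈⟨ divisorsLoop-snoc N L 1 (cycloTable n) _ ⟩
    mulP (divisorsLoop N L 1 (cycloTable n)) (when (suc (length (cycloTable n)) ∣? N) _)
      ≈⟨ mulP-cong (loop L n) ≈-refl ⟩
    mulP (prodTo n (onDivisorsOf N Φ)) (when (suc (length (cycloTable n)) ∣? N) _)
      ≡⟨ cong₂ (λ i f → mulP (prodTo n (onDivisorsOf N Φ)) (when (suc i ∣? N) f)) (length-cycloTable n) (sym (Φ-suc n)) ⟩
    prodTo (suc n) (onDivisorsOf N Φ) ∎
    where open ≈-Reasoning

-- Gauss's identity ∑_{d ∣ n} φ d = n

open RangeFold ℕ.+-0-commutativeMonoid using ()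
  renaming (fold to sumTo; fold-cong to sumTo-cong; fold-ε to sumTo-zero;
            fold-reindex to sumTo-reindex; fold-single to sumTo-single; fold-swap to sumTo-swap)

whenℕ : ∀ {A : Set} → Dec A → ℕ → ℕ
whenℕ (yes _) k = k
whenℕ (no  _) _ = 0

indicator : ∀ {A : Set} → Dec A → ℕ
indicator a = whenℕ a 1

whenℕ-⇔ : ∀ {A B : Set} (a : Dec A) (b : Dec B) k → (A → B) → (B → A) → whenℕ a k ≡ whenℕ b k
whenℕ-⇔ (yes _)  (yes _)  k _   _   = refl
whenℕ-⇔ (yes A′) (no ¬B)  k A⇒B _   = ⊥-elim (¬B (A⇒B A′))
whenℕ-⇔ (no ¬A)  (yes B′) k _   B⇒A = ⊥-elim (¬A (B⇒A B′))
whenℕ-⇔ (no _)   (no _)   k _   _   = refl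

whenℕ-yes : ∀ {A : Set} (a : Dec A) k → A → whenℕ a k ≡ k
whenℕ-yes (yes _) k _  = refl
whenℕ-yes (no ¬A) k A′ = ⊥-elim (¬A A′)

whenℕ-no : ∀ {A : Set} (a : Dec A) k → ¬ A → whenℕ a k ≡ 0
whenℕ-no (yes A′) k ¬A = ⊥-elim (¬A A′)
whenℕ-no (no _)   k _  = refl

length-filter-[_] : ∀ {P : ℕ → Set} (P? : ∀ x → Dec (P x)) x → length (filter P? [ x ]) ≡ indicator (P? x)
length-filter-[_] P? x with P? x
... | yes _ = refl
... | no  _ = refl

length-filter-applyUpTo-suc : ∀ {P : ℕ → Set} (P? : ∀ x → Dec (P x)) n →
                              length (filter P? (applyUpTo suc n)) ≡ sumTo n (λ k → indicator (P? k))
length-filter-applyUpTo-suc P? zero    = refl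
length-filter-applyUpTo-suc P? (suc n) = begin
  length (filter P? (applyUpTo suc (suc n)))                 ≡⟨ cong (length ∘ filter P?) (applyUpTo-∷ʳ suc n) ⟨
  length (filter P? (applyUpTo suc n ++ [ suc n ]))          ≡⟨ cong length (filter-++ P? (applyUpTo suc n) [ suc n ]) ⟩
  length (filter P? (applyUpTo suc n) ++ filter P? [ suc n ]) ≡⟨ length-++ (filter P? (applyUpTo suc n)) ⟩
  length (filter P? (applyUpTo suc n)) ℕ.+ length (filter P? [ suc n ])
    ≡⟨ cong₂ ℕ._+_ (length-filter-applyUpTo-suc P? n) (length-filter-[_] P? (suc n)) ⟩
  sumTo (suc n) (λ k → indicator (P? k)) ∎
  where open ≡-Reasoning

φ≡sumTo : ∀ d → φ d ≡ sumTo d (λ j → indicator (gcd j d ℕ.≟ 1))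
φ≡sumTo d = trans (cong (length ∘ filter (λ k → gcd k d ℕ.≟ 1)) (map-upTo suc d)) (length-filter-applyUpTo-suc _ d)

1≤φ : ∀ m → 1 ≤ m → 1 ≤ φ m
1≤φ (suc m) _ rewrite gcd-zeroˡ (suc m) = s≤s z≤n

positive-factor : ∀ e d {n} → 1 ≤ n → n ≡ e ℕ.* d → 1 ≤ e
positive-factor zero    d 1≤n n≡0 = ⊥-elim (ℕ.<⇒≢ 1≤n (sym n≡0))
positive-factor (suc e) d _   _   = s≤s z≤n

-- For d ∣ n, the k ≤ n with gcd k n · d = n are the j e (j ≤ d, gcd j d = 1), where n = e d.
count-gcd-quotient : ∀ n d → 1 ≤ n → 1 ≤ d →
                     sumTo n (λ k → indicator (gcd k n ℕ.* d ℕ.≟ n)) ≡ whenℕ (d ∣? n) (φ d)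
count-gcd-quotient n d 1≤n 1≤d with d ∣? n
... | no  d∤n = sumTo-zero n _ λ k _ → whenℕ-no (gcd k n ℕ.* d ℕ.≟ n) 1 λ eq → d∤n (divides (gcd k n) (sym eq))
... | yes (divides e n≡ed) = begin
  sumTo n (λ k → indicator (gcd k n ℕ.* d ℕ.≟ n))
    ≡⟨ sumTo-cong n (λ k _ → whenℕ-⇔ (gcd k n ℕ.* d ℕ.≟ n) (gcd k n ℕ.≟ e) 1
                      (λ eq → ℕ.*-cancelʳ-≡ (gcd k n) e d {{ℕ.>-nonZero 1≤d}} (trans eq n≡ed))
                      (λ eq → trans (cong (ℕ._* d) eq) (sym n≡ed))) ⟩
  sumTo n (λ k → indicator (gcd k n ℕ.≟ e))
    ≡⟨ cong (λ m → sumTo m (λ k → indicator (gcd k n ℕ.≟ e))) (trans n≡ed (ℕ.*-comm e d)) ⟩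
  sumTo (d ℕ.* e) (λ k → indicator (gcd k n ℕ.≟ e))
    ≡⟨ sumTo-reindex d e _ 1≤e (λ k e∤k → whenℕ-no (gcd k n ℕ.≟ e) 1 λ eq → e∤k (subst (_∣ k) eq (gcd[m,n]∣m k n))) ⟩
  sumTo d (λ j → indicator (gcd (j ℕ.* e) n ℕ.≟ e))
    ≡⟨ sumTo-cong d (λ j _ → whenℕ-⇔ (gcd (j ℕ.* e) n ℕ.≟ e) (gcd j d ℕ.≟ 1) 1 (coprime j) (multiple j)) ⟩
  sumTo d (λ j → indicator (gcd j d ℕ.≟ 1))
    ≡⟨ φ≡sumTo d ⟨
  φ d ∎
  where
  open ≡-Reasoning
  1≤e = positive-factor e d 1≤n n≡ed
  gcd-je : ∀ j → gcd (j ℕ.* e) n ≡ e ℕ.* gcd j d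
  gcd-je j = trans (cong₂ gcd (ℕ.*-comm j e) n≡ed) (sym (c*gcd[m,n]≡gcd[cm,cn] e j d))
  coprime : ∀ j → gcd (j ℕ.* e) n ≡ e → gcd j d ≡ 1
  coprime j eq = ℕ.*-cancelˡ-≡ (gcd j d) 1 e {{ℕ.>-nonZero 1≤e}} (trans (sym (gcd-je j)) (trans eq (sym (ℕ.*-identityʳ e))))
  multiple : ∀ j → gcd j d ≡ 1 → gcd (j ℕ.* e) n ≡ e
  multiple j eq = trans (gcd-je j) (trans (cong (e ℕ.*_) eq) (ℕ.*-identityʳ e))

unique-gcd-cofactor : ∀ n k → 1 ≤ n → InRange n k → sumTo n (λ d → indicator (gcd k n ℕ.* d ℕ.≟ n)) ≡ 1
unique-gcd-cofactor n k 1≤n (1≤k , _) with gcd[m,n]∣n k n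
... | divides q n≡qg = trans (sumTo-single n _ q (1≤q , q≤n) others) (whenℕ-yes (gcd k n ℕ.* q ℕ.≟ n) 1 gq≡n)
  where
  instance
    g≢0 : ℕ.NonZero (gcd k n)
    g≢0 = ℕ.≢-nonZero (gcd[m,n]≢0 k n (inj₁ (ℕ.<⇒≢ 1≤k ∘ sym)))
  gq≡n : gcd k n ℕ.* q ≡ n
  gq≡n = trans (ℕ.*-comm (gcd k n) q) (sym n≡qg)
  1≤q = positive-factor q (gcd k n) 1≤n n≡qg
  q≤n = ∣⇒≤ {{ℕ.>-nonZero 1≤n}} (divides (gcd k n) (sym gq≡n))
  others : ∀ d → InRange n d → d ≢ q → indicator (gcd k n ℕ.* d ℕ.≟ n) ≡ 0
  others d _ d≢q = whenℕ-no (gcd k n ℕ.* d ℕ.≟ n) 1 λ gd≡n → d≢q (ℕ.*-cancelˡ-≡ d q (gcd k n) (trans gd≡n (sym gq≡n)))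

gauss-totient : ∀ n → 1 ≤ n → sumTo n (λ d → whenℕ (d ∣? n) (φ d)) ≡ n
gauss-totient n 1≤n = begin
  sumTo n (λ d → whenℕ (d ∣? n) (φ d))
    ≡⟨ sumTo-cong n (λ d (1≤d , _) → count-gcd-quotient n d 1≤n 1≤d) ⟨
  sumTo n (λ d → sumTo n (λ k → indicator (gcd k n ℕ.* d ℕ.≟ n)))
    ≡⟨ sumTo-swap n n (λ k d → indicator (gcd k n ℕ.* d ℕ.≟ n)) ⟨
  sumTo n (λ k → sumTo n (λ d → indicator (gcd k n ℕ.* d ℕ.≟ n)))
    ≡⟨ sumTo-cong n (λ k → unique-gcd-cofactor n k 1≤n) ⟩
  sumTo n (λ _ → 1)
    ≡⟨ sumTo-ones n ⟩
  n ∎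
  where
  open ≡-Reasoning
  sumTo-ones : ∀ n → sumTo n (λ _ → 1) ≡ n
  sumTo-ones zero    = refl
  sumTo-ones (suc n) = trans (cong (ℕ._+ 1) (sumTo-ones n)) (ℕ.+-comm n 1)

UnitConstant⇒coeff₀≢0 : ∀ f → UnitConstant f → coeff f 0 ≢ 0ℤ
UnitConstant⇒coeff₀≢0 f u f₀≡0 with () ← trans (sym u) (cong (_* coeff f 0) f₀≡0)

UnitConstant-resp-≈ : ∀ {f g} → f ≈ g → UnitConstant f → UnitConstant g
UnitConstant-resp-≈ f≈g u = trans (cong₂ _*_ (sym (coeff-≈ f≈g 0)) (sym (coeff-≈ f≈g 0))) u

UnitConstant-mulP : ∀ f g → UnitConstant f → UnitConstant g → UnitConstant (mulP f g)
UnitConstant-mulP f g uf ug = begin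
  coeff (mulP f g) 0 * coeff (mulP f g) 0                 ≡⟨ cong₂ _*_ (coeff-mulP-zero f g) (coeff-mulP-zero f g) ⟩
  (coeff f 0 * coeff g 0) * (coeff f 0 * coeff g 0)       ≡⟨ solve 2 (λ a b → (a :* b) :* (a :* b) := (a :* a) :* (b :* b)) refl (coeff f 0) (coeff g 0) ⟩
  (coeff f 0 * coeff f 0) * (coeff g 0 * coeff g 0)       ≡⟨ cong₂ _*_ uf ug ⟩
  1ℤ                                                      ∎
  where open ≡-Reasoning

-- The constant term of f divides -1, hence is ±1.
UnitConstant-of-factor : ∀ f g → coeff (mulP f g) 0 ≡ - 1ℤ → UnitConstant f
UnitConstant-of-factor f g fg₀≡-1 = unit-square (coeff f 0) ∣f₀∣≡1
  where
  ∣f₀∣≡1 : ℤ.∣ coeff f 0 ∣ ≡ 1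
  ∣f₀∣≡1 = ℕ.m*n≡1⇒m≡1 _ ℤ.∣ coeff g 0 ∣
    (trans (sym (ℤ.∣i*j∣≡∣i∣*∣j∣ (coeff f 0) _)) (cong ℤ.∣_∣ (trans (sym (coeff-mulP-zero f g)) fg₀≡-1)))
  unit-square : ∀ a → ℤ.∣ a ∣ ≡ 1 → a * a ≡ 1ℤ
  unit-square (+ 1)          _ = refl
  unit-square ℤ.-[1+ zero ]  _ = refl
  unit-square (+ 0)          ()
  unit-square (+ suc (suc _)) ()
  unit-square ℤ.-[1+ suc _ ] ()

UnitConstant-prodTo : ∀ n F → (∀ d → InRange n d → UnitConstant (F d)) → UnitConstant (prodTo n F)
UnitConstant-prodTo zero    F _ = refl
UnitConstant-prodTo (suc n) F u =
  UnitConstant-mulP (prodTo n F) (F (suc n)) (UnitConstant-prodTo n F (λ d → u d ∘ InRange-suc)) (u (suc n) (InRange-top n))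

UnitConstant-when : ∀ {A : Set} (a : Dec A) f → UnitConstant f → UnitConstant (when a f)
UnitConstant-when (yes _) f u = u
UnitConstant-when (no  _) f _ = refl

IsDeg-oneP : IsDeg oneP 0
IsDeg-oneP = (λ ()) , λ { (suc k) _ → refl }

IsDeg-prodTo : ∀ n F (δ : ℕ → ℕ) → (∀ d → InRange n d → IsDeg (F d) (δ d)) → IsDeg (prodTo n F) (sumTo n δ)
IsDeg-prodTo zero    F δ _   = IsDeg-oneP
IsDeg-prodTo (suc n) F δ deg =
  mulP-IsDeg (prodTo n F) (F (suc n)) _ _ (IsDeg-prodTo n F δ (λ d → deg d ∘ InRange-suc)) (deg (suc n) (InRange-top n))

IsDeg-when : ∀ {A : Set} (a : Dec A) f δ → IsDeg f δ → IsDeg (when a f) (whenℕ a δ)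
IsDeg-when (yes _) f δ deg = deg
IsDeg-when (no  _) f δ _   = IsDeg-oneP

infix 4 _∣P_
_∣P_ : Poly → Poly → Set
A ∣P P = Σ Poly λ Q → mulP A Q ≈ P

∣P-trans : ∀ {A B C} → A ∣P B → B ∣P C → A ∣P C
∣P-trans {A} (Q₁ , AQ₁≈B) (Q₂ , BQ₂≈C) =
  mulP Q₁ Q₂ , ≈-trans (≈-sym (mulP-assoc A Q₁ Q₂)) (≈-trans (mulP-cong AQ₁≈B (≈-refl {Q₂})) BQ₂≈C)

-- Coprimality over ℚ, witnessed over ℤ.
CoprimeUpToConstant : Poly → Poly → Set
CoprimeUpToConstant A B = Σ Poly λ U → Σ Poly λ V → Σ ℤ λ c → c ≢ 0ℤ × addP (mulP U A) (mulP V B) ≈ constP c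

CoprimeUpToConstant-sym : ∀ {A B} → CoprimeUpToConstant A B → CoprimeUpToConstant B A
CoprimeUpToConstant-sym {A} {B} (U , V , c , c≢0 , eq) = V , U , c , c≢0 , ≈-trans (addP-comm (mulP V B) (mulP U A)) eq

CoprimeUpToConstant-oneˡ : ∀ B → CoprimeUpToConstant oneP B
CoprimeUpToConstant-oneˡ B = oneP , [] , 1ℤ , (λ ()) , mk≈ λ { zero → refl ; (suc k) → refl }

CoprimeUpToConstant-mulPˡ : ∀ {A A′ B} → CoprimeUpToConstant A B → CoprimeUpToConstant A′ B → CoprimeUpToConstant (mulP A A′) B
CoprimeUpToConstant-mulPˡ {A} {A′} {B} (U , V , c , c≢0 , eq) (U′ , V′ , c′ , c′≢0 , eq′) =
  mulP U U′ , addP (mulP V (addP (mulP U′ A′) (mulP V′ B))) (mulP (mulP U A) V′) , c * c′ , *-≢0 c≢0 c′≢0 , (begin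
    addP (mulP (mulP U U′) (mulP A A′)) (mulP (addP (mulP V (addP (mulP U′ A′) (mulP V′ B))) (mulP (mulP U A) V′)) B)
      ≈⟨ solveP 7 (λ u u′ a a′ v v′ b →
            (((u ⊗ u′) ⊗ (a ⊗ a′)) ⊕ (((v ⊗ ((u′ ⊗ a′) ⊕ (v′ ⊗ b))) ⊕ ((u ⊗ a) ⊗ v′)) ⊗ b))
            ⊜ (((u ⊗ a) ⊕ (v ⊗ b)) ⊗ ((u′ ⊗ a′) ⊕ (v′ ⊗ b))))
          ≈-refl U U′ A A′ V V′ B ⟩
    mulP (addP (mulP U A) (mulP V B)) (addP (mulP U′ A′) (mulP V′ B))
      ≈⟨ mulP-cong eq eq′ ⟩
    mulP (constP c) (constP c′)
      ≈⟨ mk≈ (λ { zero → ℤ.+-identityʳ (c * c′) ; (suc k) → refl }) ⟩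
    constP (c * c′) ∎)
  where open ≈-Reasoning

CoprimeUpToConstant-prodTo : ∀ n F B → (∀ d → InRange n d → CoprimeUpToConstant (F d) B) → CoprimeUpToConstant (prodTo n F) B
CoprimeUpToConstant-prodTo zero    F B _   = CoprimeUpToConstant-oneˡ B
CoprimeUpToConstant-prodTo (suc n) F B cop =
  CoprimeUpToConstant-mulPˡ (CoprimeUpToConstant-prodTo n F B (λ d → cop d ∘ InRange-suc)) (cop (suc n) (InRange-top n))

infix 4 _∣ᶜ_
_∣ᶜ_ : ℤ → Poly → Set
c ∣ᶜ f = ∀ k → Σ ℤ λ y → coeff f k ≡ y * c

-- Dividing by C one coefficient at a time, its constant term ±1 never introduces a denominator.
∣ᶜ-cancel-UnitConstant : ∀ C c Q → UnitConstant C → c ∣ᶜ mulP C Q → c ∣ᶜ Q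
∣ᶜ-cancel-UnitConstant C c []      u c∣CQ k = 0ℤ , sym (ℤ.*-zeroˡ c)
∣ᶜ-cancel-UnitConstant C c (q ∷ Q) u c∣CQ = λ { zero → c∣q ; (suc k) → ∣ᶜ-cancel-UnitConstant C c Q u c∣CQ′ k }
  where
  coeff-CqQ : ∀ k → coeff (mulP C (q ∷ Q)) k ≡ q * coeff C k + coeff (shiftP (mulP C Q)) k
  coeff-CqQ k = trans (coeff-≈ (mulP-consʳ C q Q) k)
                      (trans (coeff-addP (scaleP q C) (shiftP (mulP C Q)) k) (cong (_+ coeff (shiftP (mulP C Q)) k) (coeff-scaleP q C k)))
  y₀ = proj₁ (c∣CQ 0)
  qC₀≡y₀c : q * coeff C 0 ≡ y₀ * c
  qC₀≡y₀c = trans (sym (ℤ.+-identityʳ _)) (trans (sym (coeff-CqQ 0)) (proj₂ (c∣CQ 0)))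
  c∣q : Σ ℤ λ y → q ≡ y * c
  c∣q = y₀ * coeff C 0 , (begin
    q                                    ≡⟨ ℤ.*-identityʳ q ⟨
    q * 1ℤ                               ≡⟨ cong (q *_) u ⟨
    q * (coeff C 0 * coeff C 0)          ≡⟨ ℤ.*-assoc q (coeff C 0) (coeff C 0) ⟨
    (q * coeff C 0) * coeff C 0          ≡⟨ cong (_* coeff C 0) qC₀≡y₀c ⟩
    (y₀ * c) * coeff C 0                 ≡⟨ solve 3 (λ a b d → (a :* b) :* d := (a :* d) :* b) refl y₀ c (coeff C 0) ⟩
    (y₀ * coeff C 0) * c                 ∎)
    where open ≡-Reasoning
  c∣CQ′ : c ∣ᶜ mulP C Q
  c∣CQ′ k = proj₁ (c∣CQ (suc k)) - proj₁ c∣q * coeff C (suc k) , (begin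
    coeff (mulP C Q) k
      ≡⟨ solve 2 (λ x z → z := (x :+ z) :- x) refl (q * coeff C (suc k)) (coeff (mulP C Q) k) ⟩
    (q * coeff C (suc k) + coeff (mulP C Q) k) - q * coeff C (suc k)
      ≡⟨ cong₂ (λ a b → a - b * coeff C (suc k)) (trans (sym (coeff-CqQ (suc k))) (proj₂ (c∣CQ (suc k)))) (proj₂ c∣q) ⟩
    proj₁ (c∣CQ (suc k)) * c - (proj₁ c∣q * c) * coeff C (suc k)
      ≡⟨ solve 4 (λ a b d e → a :* e :- b :* e :* d := (a :- b :* d) :* e) refl (proj₁ (c∣CQ (suc k))) (proj₁ c∣q) (coeff C (suc k)) c ⟩
    (proj₁ (c∣CQ (suc k)) - proj₁ c∣q * coeff C (suc k)) * c ∎)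
    where open ≡-Reasoning

∣ᶜ⇒scaleP : ∀ c Q → c ∣ᶜ Q → Σ Poly λ Q′ → Q ≈ scaleP c Q′
∣ᶜ⇒scaleP c []      _   = [] , ≈-refl
∣ᶜ⇒scaleP c (q ∷ Q) c∣Q with ∣ᶜ⇒scaleP c Q (c∣Q ∘ suc)
... | Q′ , Q≈cQ′ = proj₁ (c∣Q 0) ∷ Q′ , mk≈ λ { zero → trans (proj₂ (c∣Q 0)) (ℤ.*-comm _ c) ; (suc k) → coeff-≈ Q≈cQ′ k }

mulP-scaleʳ : ∀ a f g → mulP f (scaleP a g) ≈ scaleP a (mulP f g)
mulP-scaleʳ a f g = ≈-trans (mulP-comm f (scaleP a g)) (≈-trans (mulP-scaleˡ a g f) (mk≈ λ k →
  trans (coeff-scaleP a (mulP g f) k) (trans (cong (a *_) (coeff-≈ (mulP-comm g f) k)) (sym (coeff-scaleP a (mulP f g) k)))))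

-- From U A + V B = c: c P = A B (U Q_B + V Q_A); the unit constant of A B lets c be divided out.
mulP-∣P : ∀ {A B P} → A ∣P P → B ∣P P → CoprimeUpToConstant A B → UnitConstant (mulP A B) → mulP A B ∣P P
mulP-∣P {A} {B} {P} (Q_A , AQ_A≈P) (Q_B , BQ_B≈P) (U , V , c , c≢0 , UA+VB≈c) u = W′ , mk≈ λ k → ℤ.*-cancelˡ-≡ c _ _ {{ℤ.≢-nonZero c≢0}} (c·coeff k)
  where
  W = addP (mulP U Q_B) (mulP V Q_A)
  cP≈ABW : mulP (constP c) P ≈ mulP (mulP A B) W
  cP≈ABW = begin
    mulP (constP c) P
      ≈⟨ mulP-cong (≈-sym UA+VB≈c) (≈-refl {P}) ⟩
    mulP (addP (mulP U A) (mulP V B)) P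
      ≈⟨ mulP-distribʳ (mulP U A) (mulP V B) P ⟩
    addP (mulP (mulP U A) P) (mulP (mulP V B) P)
      ≈⟨ addP-cong (mulP-cong (≈-refl {mulP U A}) (≈-sym BQ_B≈P)) (mulP-cong (≈-refl {mulP V B}) (≈-sym AQ_A≈P)) ⟩
    addP (mulP (mulP U A) (mulP B Q_B)) (mulP (mulP V B) (mulP A Q_A))
      ≈⟨ solveP 6 (λ u a v b qa qb → (((u ⊗ a) ⊗ (b ⊗ qb)) ⊕ ((v ⊗ b) ⊗ (a ⊗ qa))) ⊜ ((a ⊗ b) ⊗ ((u ⊗ qb) ⊕ (v ⊗ qa))))
                  ≈-refl U A V B Q_A Q_B ⟩
    mulP (mulP A B) W ∎
    where open ≈-Reasoning
  c∣W : c ∣ᶜ W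
  c∣W = ∣ᶜ-cancel-UnitConstant (mulP A B) c W u λ k →
    coeff P k , trans (sym (coeff-≈ cP≈ABW k)) (trans (coeff-≈ (mulP-constˡ c P) k) (trans (coeff-scaleP c P k) (ℤ.*-comm c _)))
  W′ = proj₁ (∣ᶜ⇒scaleP c W c∣W)
  W≈cW′ = proj₂ (∣ᶜ⇒scaleP c W c∣W)
  c·coeff : ∀ k → c * coeff (mulP (mulP A B) W′) k ≡ c * coeff P k
  c·coeff k = begin
    c * coeff (mulP (mulP A B) W′) k          ≡⟨ coeff-scaleP c (mulP (mulP A B) W′) k ⟨
    coeff (scaleP c (mulP (mulP A B) W′)) k   ≡⟨ coeff-≈ (mulP-scaleʳ c (mulP A B) W′) k ⟨
    coeff (mulP (mulP A B) (scaleP c W′)) k   ≡⟨ coeff-≈ (mulP-cong (≈-refl {mulP A B}) W≈cW′) k ⟨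
    coeff (mulP (mulP A B) W) k               ≡⟨ coeff-≈ cP≈ABW k ⟨
    coeff (mulP (constP c) P) k               ≡⟨ trans (coeff-≈ (mulP-constˡ c P) k) (coeff-scaleP c P k) ⟩
    c * coeff P k                             ∎
    where open ≡-Reasoning

-- x ^ n - 1 is the product of the Φ d with d ∣ n

InRange-induction : (P : ℕ → Set) → (∀ m → (∀ k → InRange m k → P k) → P (suc m)) → ∀ n → 1 ≤ n → P n
InRange-induction P step n 1≤n = below n n (1≤n , ℕ.≤-refl)
  where
  below : ∀ m k → InRange m k → P k
  below zero    k (1≤k , k≤0)   = ⊥-elim (ℕ.<⇒≱ 1≤k k≤0)
  below (suc m) k (1≤k , k≤1+m) with ℕ.m≤n⇒m<n∨m≡n k≤1+m
  ... | inj₁ k<1+m = below m k (1≤k , ℕ.≤-pred k<1+m)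
  ... | inj₂ refl  = step m (below m)

CyclotomicFactorisation : ℕ → Set
CyclotomicFactorisation n = prodTo n (onDivisorsOf n Φ) ≈ x^ n −1

newDivisorsProd : ℕ → ℕ → ℕ → Poly
newDivisorsProd e g n = prodTo n (λ j → when ((j ∣? e) ×-dec ¬? (j ∣? g)) (Φ j))

x^−1-split-at-divisor : ∀ g e′ → 1 ≤ g → g ∣ suc e′ → ¬ suc e′ ∣ g → (∀ k → InRange (suc e′) k → CyclotomicFactorisation k) →
                        x^ suc e′ −1 ≈ mulP (x^ g −1) (mulP (newDivisorsProd (suc e′) g e′) (Φ (suc e′)))
x^−1-split-at-divisor g e′ 1≤g g∣e e∤g factorised = begin
  x^ e −1
    ≈⟨ factorised e (InRange-top e′) ⟨
  prodTo e (onDivisorsOf e Φ)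
    ≈⟨ prodTo-cong e (λ j _ → when-split (j ∣? e) (j ∣? g) ((j ∣? e) ×-dec ¬? (j ∣? g)) (Φ j)
                         (λ j∣e → [ inj₁ , (λ j∤g → inj₂ (j∣e , j∤g)) ]′ (toSum (j ∣? g)))
                         (λ j∣g → ∣-trans j∣g g∣e) proj₁ (λ j∣g (_ , j∤g) → j∤g j∣g)) ⟩
  prodTo e (λ j → mulP (onDivisorsOf g Φ j) (when ((j ∣? e) ×-dec ¬? (j ∣? g)) (Φ j)))
    ≈⟨ prodTo-mulP e (onDivisorsOf g Φ) _ ⟩
  mulP (prodTo e (onDivisorsOf g Φ)) (mulP (newDivisorsProd e g e′) (when ((e ∣? e) ×-dec ¬? (e ∣? g)) (Φ e)))
    ≈⟨ mulP-cong (≈-trans (prodTo-onDivisorsOf-beyond g e Φ 1≤g g≤e) (factorised g (1≤g , g≤e)))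
                 (mulP-cong (≈-refl {newDivisorsProd e g e′}) (≈-reflexive (when-yes ((e ∣? e) ×-dec ¬? (e ∣? g)) (Φ e) (∣-refl , e∤g)))) ⟩
  mulP (x^ g −1) (mulP (newDivisorsProd e g e′) (Φ e)) ∎
  where
  open ≈-Reasoning
  e = suc e′
  g≤e = ∣⇒≤ g∣e

-- Let g ∣ d, e with A (x ^ d - 1) + B (x ^ e - 1) = x ^ g - 1, and e = k g. Then g < e, so
-- geomSum g k = (x ^ e - 1) / (x ^ g - 1) = T Φ e, and geomSum g k ≡ k modulo x ^ g - 1
-- turns the Bézout identity into a combination of Φ d and Φ e equal to k.
Φ-coprime : ∀ d e → 1 ≤ d → 1 ≤ e → ¬ e ∣ d → CyclotomicFactorisation d → (∀ k → InRange e k → CyclotomicFactorisation k) →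
            CoprimeUpToConstant (Φ d) (Φ e)
Φ-coprime (suc d′) (suc e′) _ _ e∤d factorised-d factorised-e with x^−1-Bézout (suc d′) (suc e′)
... | g , g∣d , g∣e@(divides k e≡kg) , A , B , bézout = U , V , + k , k≢0 , (begin
  addP (mulP U (Φ d)) (mulP V (Φ e))
    ≈⟨ solveP 8 (λ t pe h a rd pd b re →
                  (((⊝ ((h ⊗ a) ⊗ rd)) ⊗ pd) ⊕ ((t ⊕ (⊝ ((h ⊗ b) ⊗ re))) ⊗ pe))
                  ⊜ ((t ⊗ pe) ⊕ (⊝ (h ⊗ ((a ⊗ (rd ⊗ pd)) ⊕ (b ⊗ (re ⊗ pe)))))))
                ≈-refl T (Φ e) H A R_d (Φ d) B R_e ⟩
  addP (mulP T (Φ e)) (negP (mulP H (addP (mulP A (mulP R_d (Φ d))) (mulP B (mulP R_e (Φ e))))))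
    ≈⟨ addP-cong (≈-sym geomSum≈TΦe) (negP-cong (mulP-cong (≈-refl {H})
                 (addP-cong (mulP-cong (≈-refl {A}) x^d−1≈) (mulP-cong (≈-refl {B}) x^e−1≈)))) ⟩
  addP (geomSum g k) (negP (mulP H (addP (mulP A (x^ d −1)) (mulP B (x^ e −1)))))
    ≈⟨ addP-cong (≈-refl {geomSum g k}) (negP-cong (≈-trans (mulP-cong (≈-refl {H}) bézout) (mulP-comm H (x^ g −1)))) ⟩
  addP (geomSum g k) (negP (mulP (x^ g −1) H))
    ≈⟨ addP-cong (≈-refl {geomSum g k}) (negP-cong (≈-sym (proj₂ (geomSum-mod g k)))) ⟩
  addP (geomSum g k) (negP (addP (geomSum g k) (negP (constP (+ k)))))
    ≈⟨ solveP 2 (λ G C → (G ⊕ (⊝ (G ⊕ (⊝ C)))) ⊜ C) ≈-refl (geomSum g k) (constP (+ k)) ⟩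
  constP (+ k) ∎)
  where
  open ≈-Reasoning
  d = suc d′
  e = suc e′
  R_d = prodTo d′ (onDivisorsOf d Φ)
  R_e = prodTo e′ (onDivisorsOf e Φ)
  x^d−1≈ : mulP R_d (Φ d) ≈ x^ d −1
  x^d−1≈ = ≈-trans (≈-sym (prodTo-onDivisorsOf-suc d′ Φ)) factorised-d
  x^e−1≈ : mulP R_e (Φ e) ≈ x^ e −1
  x^e−1≈ = ≈-trans (≈-sym (prodTo-onDivisorsOf-suc e′ Φ)) (factorised-e e (InRange-top e′))
  1≤g : 1 ≤ g
  1≤g = ℕ.n≢0⇒n>0 λ { refl → ℕ.1+n≢0 (trans e≡kg (ℕ.*-zeroʳ k)) }
  k≢0 : + k ≢ 0ℤ
  k≢0 refl = ℕ.1+n≢0 e≡kg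
  e∤g : ¬ e ∣ g
  e∤g e∣g = e∤d (∣-trans e∣g g∣d)
  T = newDivisorsProd e g e′
  H = proj₁ (geomSum-mod g k)
  geomSum≈TΦe : geomSum g k ≈ mulP T (Φ e)
  geomSum≈TΦe = mulP-cancelˡ (x^ g −1) (geomSum g k) (mulP T (Φ e)) (coeff-x^−1-zero g 1≤g)
    (≈-trans (x^−1*geomSum g k) (≈-trans (≈-reflexive (cong x^_−1 (sym e≡kg))) (x^−1-split-at-divisor g e′ 1≤g g∣e e∤g factorised-e)))
  U = negP (mulP (mulP H A) R_d)
  V = addP T (negP (mulP (mulP H B) R_e))

record CyclotomicFacts (n : ℕ) : Set where
  field
    factorisation : CyclotomicFactorisation n
    unitConstant  : UnitConstant (Φ n)
    degree        : IsDeg (Φ n) (φ n)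

IsDeg⇒<length : ∀ f n → IsDeg f n → n < length f
IsDeg⇒<length f n (fₙ≢0 , _) = ℕ.≰⇒> λ len≤n → fₙ≢0 (coeff-≥length f n len≤n)

CoprimeUpToConstant-when : ∀ {A : Set} (a : Dec A) {f B} → CoprimeUpToConstant f B → CoprimeUpToConstant (when a f) B
CoprimeUpToConstant-when (yes _) cop = cop
CoprimeUpToConstant-when (no  _) {B = B} _ = CoprimeUpToConstant-oneˡ B

Φ-pairwise-coprime : ∀ m → (∀ k → InRange m k → CyclotomicFactorisation k) →
                     ∀ d e → InRange m d → InRange m e → d ≢ e → CoprimeUpToConstant (Φ d) (Φ e)
Φ-pairwise-coprime m factorised d e (1≤d , d≤m) (1≤e , e≤m) d≢e with e ∣? d
... | no  e∤d = Φ-coprime d e 1≤d 1≤e e∤d (factorised d (1≤d , d≤m)) λ k (1≤k , k≤e) → factorised k (1≤k , ℕ.≤-trans k≤e e≤m)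
... | yes e∣d = CoprimeUpToConstant-sym (Φ-coprime e d 1≤e 1≤d (λ d∣e → d≢e (∣-antisym d∣e e∣d)) (factorised e (1≤e , e≤m))
                                          λ k (1≤k , k≤d) → factorised k (1≤k , ℕ.≤-trans k≤d d≤m))

Φ-∣P-x^−1 : ∀ j n → CyclotomicFactorisation (suc j) → suc j ∣ n → Φ (suc j) ∣P x^ n −1
Φ-∣P-x^−1 j n factorised j+1∣n =
  ∣P-trans {Φ (suc j)} {x^ suc j −1}
    (R , ≈-trans (mulP-comm (Φ (suc j)) R) (≈-trans (≈-sym (prodTo-onDivisorsOf-suc j Φ)) factorised))
    (x^−1-∣ {suc j} {n} j+1∣n)
  where R = prodTo j (onDivisorsOf (suc j) Φ)

module CyclotomicStep (m : ℕ) (facts : ∀ k → InRange m k → CyclotomicFacts k) where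
  n = suc m
  D = prodTo m (onDivisorsOf n Φ)

  factorised : ∀ k → InRange m k → CyclotomicFactorisation k
  factorised k = CyclotomicFacts.factorisation ∘ facts k

  unit-below : ∀ k → InRange m k → UnitConstant (Φ k)
  unit-below k = CyclotomicFacts.unitConstant ∘ facts k

  UnitConstant-prefix : ∀ j → j ≤ m → UnitConstant (prodTo j (onDivisorsOf n Φ))
  UnitConstant-prefix j j≤m = UnitConstant-prodTo j _ λ d (1≤d , d≤j) →
    UnitConstant-when (d ∣? n) (Φ d) (unit-below d (1≤d , ℕ.≤-trans d≤j j≤m))

  prefix-∣P : ∀ j → j ≤ m → prodTo j (onDivisorsOf n Φ) ∣P x^ n −1
  prefix-∣P zero    _     = x^ n −1 , mulP-identityˡ (x^ n −1)
  prefix-∣P (suc j) j+1≤m with suc j ∣? n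
  ... | yes j+1∣n = mulP-∣P (prefix-∣P j (ℕ.<⇒≤ j+1≤m)) (Φ-∣P-x^−1 j n (factorised (suc j) (s≤s z≤n , j+1≤m)) j+1∣n)
                            coprime
                            (UnitConstant-mulP (prodTo j (onDivisorsOf n Φ)) (Φ (suc j))
                              (UnitConstant-prefix j (ℕ.<⇒≤ j+1≤m)) (unit-below (suc j) (s≤s z≤n , j+1≤m)))
    where
    coprime : CoprimeUpToConstant (prodTo j (onDivisorsOf n Φ)) (Φ (suc j))
    coprime = CoprimeUpToConstant-prodTo j _ _ λ d (1≤d , d≤j) →
      CoprimeUpToConstant-when (d ∣? n)
        (Φ-pairwise-coprime m factorised d (suc j) (1≤d , ℕ.≤-trans d≤j (ℕ.<⇒≤ j+1≤m)) (s≤s z≤n , j+1≤m) (ℕ.<⇒≢ (s≤s d≤j)))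
  ... | no  _ with prefix-∣P j (ℕ.<⇒≤ j+1≤m)
  ...   | R , PR≈x^n−1 = R , ≈-trans (mulP-cong (mulP-identityʳ (prodTo j (onDivisorsOf n Φ))) (≈-refl {R})) PR≈x^n−1

  S = sumTo m (λ d → whenℕ (d ∣? n) (φ d))

  IsDeg-D : IsDeg D S
  IsDeg-D = IsDeg-prodTo m _ _ λ d (1≤d , d≤m) → IsDeg-when (d ∣? n) (Φ d) (φ d) (CyclotomicFacts.degree (facts d (1≤d , d≤m)))

  Q = proj₁ (prefix-∣P m ℕ.≤-refl)
  DQ≈x^n−1 = proj₂ (prefix-∣P m ℕ.≤-refl)

  Φn≈Q : Φ n ≈ Q
  Φn≈Q = subst (_≈ Q) (sym (Φ-suc m)) (divExact-correct (xPowMinusOne n) (prodDivisors n (cycloTable m)) Q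
    (UnitConstant-resp-≈ (≈-sym (prodDivisors-cycloTable n m)) (UnitConstant-prefix m ℕ.≤-refl))
    (≈-trans (mulP-cong (prodDivisors-cycloTable n m) (≈-refl {Q})) (≈-trans DQ≈x^n−1 (≈-sym (xPowMinusOne≈x^−1 n))))
    λ k len≤k → Q-degree k (ℕ.<-≤-trans n<length len≤k))
    where
    x^n−1-deg = x^−1-IsDeg n (s≤s z≤n)
    n<length : n < length (xPowMinusOne n)
    n<length = IsDeg⇒<length (xPowMinusOne n) n (IsDeg-resp-≈ n (≈-sym (xPowMinusOne≈x^−1 n)) x^n−1-deg)
    Q-degree : DegreeAtMost Q n
    Q-degree = quotient-DegreeAtMost D Q (x^ n −1) S n IsDeg-D DQ≈x^n−1 (DegreeAtMost-mono (x^ n −1) (ℕ.m≤n+m n S) (proj₂ x^n−1-deg))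

  DΦn≈x^n−1 : mulP D (Φ n) ≈ x^ n −1
  DΦn≈x^n−1 = ≈-trans (mulP-cong (≈-refl {D}) Φn≈Q) DQ≈x^n−1

  unit : UnitConstant (Φ n)
  unit = UnitConstant-of-factor (Φ n) D (trans (coeff-≈ (mulP-comm (Φ n) D) 0) (coeff-≈ DΦn≈x^n−1 0))

  degree : IsDeg (Φ n) (φ n)
  degree with ≈0⊎IsDeg (Φ n)
  ... | inj₁ Φn≈0 = ⊥-elim (proj₁ (x^−1-IsDeg n (s≤s z≤n))
          (trans (sym (coeff-≈ DΦn≈x^n−1 n)) (trans (coeff-≈ (mulP-cong (≈-refl {D}) Φn≈0) n) (coeff-≈ (mulP-zeroʳ D) n))))
  ... | inj₂ (δ , deg-δ) = subst (IsDeg (Φ n)) (ℕ.+-cancelˡ-≡ S δ (φ n) (trans S+δ≡n (sym S+φn≡n))) deg-δ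
    where
    S+δ≡n : S ℕ.+ δ ≡ n
    S+δ≡n = IsDeg-unique (x^ n −1) (IsDeg-resp-≈ (S ℕ.+ δ) DΦn≈x^n−1 (mulP-IsDeg D (Φ n) S δ IsDeg-D deg-δ)) (x^−1-IsDeg n (s≤s z≤n))
    S+φn≡n : S ℕ.+ φ n ≡ n
    S+φn≡n = trans (cong (S ℕ.+_) (sym (whenℕ-yes (n ∣? n) (φ n) ∣-refl))) (gauss-totient n (s≤s z≤n))

  facts-n : CyclotomicFacts n
  facts-n = record { factorisation = ≈-trans (prodTo-onDivisorsOf-suc m Φ) DΦn≈x^n−1 ; unitConstant = unit ; degree = degree }

cyclotomic-facts : ∀ n → 1 ≤ n → CyclotomicFacts n
cyclotomic-facts = InRange-induction CyclotomicFacts CyclotomicStep.facts-n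

Φ-factorisation : ∀ n → 1 ≤ n → CyclotomicFactorisation n
Φ-factorisation n = CyclotomicFacts.factorisation ∘ cyclotomic-facts n

Φ-UnitConstant : ∀ n → 1 ≤ n → UnitConstant (Φ n)
Φ-UnitConstant n = CyclotomicFacts.unitConstant ∘ cyclotomic-facts n

Φ-IsDeg : ∀ n → 1 ≤ n → IsDeg (Φ n) (φ n)
Φ-IsDeg n = CyclotomicFacts.degree ∘ cyclotomic-facts n

-- Substituting x ^ p for x

expand : ℕ → Poly → Poly
expand p []      = []
expand p (a ∷ f) = addP (constP a) (mulP (mono p) (expand p f))

coeff-mono*-below : ∀ p E k → k < p → coeff (mulP (mono p) E) k ≡ 0ℤ
coeff-mono*-below (suc p) E zero    _         = coeff-≈ (mulP-shiftˡ (mono p) E) 0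
coeff-mono*-below (suc p) E (suc k) (s≤s k<p) = trans (coeff-≈ (mulP-shiftˡ (mono p) E) (suc k)) (coeff-mono*-below p E k k<p)

coeff-mono*-shift : ∀ p E k → coeff (mulP (mono p) E) (p ℕ.+ k) ≡ coeff E k
coeff-mono*-shift zero    E k = coeff-≈ (mulP-identityˡ E) k
coeff-mono*-shift (suc p) E k = trans (coeff-≈ (mulP-shiftˡ (mono p) E) (suc (p ℕ.+ k))) (coeff-mono*-shift p E k)

coeff-expand-cons : ∀ p a f k → 1 ≤ k → coeff (expand p (a ∷ f)) k ≡ coeff (mulP (mono p) (expand p f)) k
coeff-expand-cons p a f (suc k) _ = trans (coeff-addP (constP a) (mulP (mono p) (expand p f)) (suc k)) (ℤ.+-identityˡ _)

coeff-expand-multiple : ∀ p f j → 1 ≤ p → coeff (expand p f) (j ℕ.* p) ≡ coeff f j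
coeff-expand-multiple p []      j       _   = refl
coeff-expand-multiple p (a ∷ f) zero    1≤p =
  trans (coeff-addP (constP a) (mulP (mono p) (expand p f)) 0) (trans (cong (λ z → a + z) (coeff-mono*-below p (expand p f) 0 1≤p)) (ℤ.+-identityʳ a))
coeff-expand-multiple p (a ∷ f) (suc j) 1≤p = begin
  coeff (expand p (a ∷ f)) (p ℕ.+ j ℕ.* p)      ≡⟨ coeff-expand-cons p a f (p ℕ.+ j ℕ.* p) (ℕ.≤-trans 1≤p (ℕ.m≤m+n p _)) ⟩
  coeff (mulP (mono p) (expand p f)) (p ℕ.+ j ℕ.* p) ≡⟨ coeff-mono*-shift p (expand p f) (j ℕ.* p) ⟩
  coeff (expand p f) (j ℕ.* p)                  ≡⟨ coeff-expand-multiple p f j 1≤p ⟩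
  coeff f j                                     ∎
  where open ≡-Reasoning

coeff-expand-other : ∀ p f k → 1 ≤ p → ¬ p ∣ k → coeff (expand p f) k ≡ 0ℤ
coeff-expand-other p []      k       _   _   = refl
coeff-expand-other p (a ∷ f) zero    _   p∤0 = ⊥-elim (p∤0 (divides 0 refl))
coeff-expand-other p (a ∷ f) (suc k) 1≤p p∤k with suc k ℕ.<? p
... | yes k<p = trans (coeff-expand-cons p a f (suc k) (s≤s z≤n)) (coeff-mono*-below p (expand p f) (suc k) k<p)
... | no  k≮p = begin
  coeff (expand p (a ∷ f)) (suc k)                       ≡⟨ coeff-expand-cons p a f (suc k) (s≤s z≤n) ⟩
  coeff (mulP (mono p) (expand p f)) (suc k)             ≡⟨ cong (coeff (mulP (mono p) (expand p f))) (ℕ.m+[n∸m]≡n p≤k) ⟨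
  coeff (mulP (mono p) (expand p f)) (p ℕ.+ (suc k ∸ p)) ≡⟨ coeff-mono*-shift p (expand p f) (suc k ∸ p) ⟩
  coeff (expand p f) (suc k ∸ p)                         ≡⟨ coeff-expand-other p f (suc k ∸ p) 1≤p p∤k∸p ⟩
  0ℤ                                                     ∎
  where
  open ≡-Reasoning
  p≤k = ℕ.≮⇒≥ k≮p
  p∤k∸p : ¬ p ∣ suc k ∸ p
  p∤k∸p p∣k∸p = p∤k (subst (p ∣_) (ℕ.m+[n∸m]≡n p≤k) (∣m∣n⇒∣m+n ∣-refl p∣k∸p))

expand-unique : ∀ p f h → 1 ≤ p → (∀ j → coeff h (j ℕ.* p) ≡ coeff f j) → (∀ k → ¬ p ∣ k → coeff h k ≡ 0ℤ) → h ≈ expand p f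
expand-unique p f h 1≤p at-multiples elsewhere = mk≈ λ k → by-cases k (p ∣? k)
  where
  by-cases : ∀ k → Dec (p ∣ k) → coeff h k ≡ coeff (expand p f) k
  by-cases _ (yes (divides j refl)) = trans (at-multiples j) (sym (coeff-expand-multiple p f j 1≤p))
  by-cases k (no p∤k)               = trans (elsewhere k p∤k) (sym (coeff-expand-other p f k 1≤p p∤k))

expand-cong : ∀ p {f g} → 1 ≤ p → f ≈ g → expand p f ≈ expand p g
expand-cong p {f} {g} 1≤p f≈g = ≈-sym (expand-unique p f (expand p g) 1≤p
  (λ j → trans (coeff-expand-multiple p g j 1≤p) (sym (coeff-≈ f≈g j))) (λ k p∤k → coeff-expand-other p g k 1≤p p∤k))

expand-addP : ∀ p f g → 1 ≤ p → expand p (addP f g) ≈ addP (expand p f) (expand p g)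
expand-addP p f g 1≤p = ≈-sym (expand-unique p (addP f g) (addP (expand p f) (expand p g)) 1≤p
  (λ j → trans (coeff-addP (expand p f) (expand p g) (j ℕ.* p))
               (trans (cong₂ _+_ (coeff-expand-multiple p f j 1≤p) (coeff-expand-multiple p g j 1≤p)) (sym (coeff-addP f g j))))
  (λ k p∤k → trans (coeff-addP (expand p f) (expand p g) k) (cong₂ _+_ (coeff-expand-other p f k 1≤p p∤k) (coeff-expand-other p g k 1≤p p∤k))))

expand-scaleP : ∀ p a f → 1 ≤ p → expand p (scaleP a f) ≈ scaleP a (expand p f)
expand-scaleP p a f 1≤p = ≈-sym (expand-unique p (scaleP a f) (scaleP a (expand p f)) 1≤p
  (λ j → trans (coeff-scaleP a (expand p f) (j ℕ.* p)) (trans (cong (a *_) (coeff-expand-multiple p f j 1≤p)) (sym (coeff-scaleP a f j))))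
  (λ k p∤k → trans (coeff-scaleP a (expand p f) k) (*-≡0ʳ a (coeff-expand-other p f k 1≤p p∤k))))

expand-shiftP : ∀ p f → expand p (shiftP f) ≈ mulP (mono p) (expand p f)
expand-shiftP p f = mk≈ λ k → trans (coeff-addP (constP 0ℤ) (mulP (mono p) (expand p f)) k)
                                    (trans (cong (_+ coeff (mulP (mono p) (expand p f)) k) (coeff-zero k)) (ℤ.+-identityˡ _))
  where
  coeff-zero : ∀ k → coeff (constP 0ℤ) k ≡ 0ℤ
  coeff-zero zero    = refl
  coeff-zero (suc k) = refl

expand-mulP : ∀ p f g → 1 ≤ p → expand p (mulP f g) ≈ mulP (expand p f) (expand p g)
expand-mulP p []      g 1≤p = ≈-refl
expand-mulP p (a ∷ f) g 1≤p = begin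
  expand p (addP (scaleP a g) (shiftP (mulP f g)))
    ≈⟨ expand-addP p (scaleP a g) (shiftP (mulP f g)) 1≤p ⟩
  addP (expand p (scaleP a g)) (expand p (shiftP (mulP f g)))
    ≈⟨ addP-cong (expand-scaleP p a g 1≤p) (≈-trans (expand-shiftP p (mulP f g)) (mulP-cong (≈-refl {mono p}) (expand-mulP p f g 1≤p))) ⟩
  addP (scaleP a (expand p g)) (mulP (mono p) (mulP (expand p f) (expand p g)))
    ≈⟨ addP-cong (≈-sym (mulP-constˡ a (expand p g))) ≈-refl ⟩
  addP (mulP (constP a) (expand p g)) (mulP (mono p) (mulP (expand p f) (expand p g)))
    ≈⟨ solveP 4 (λ A M F G → ((A ⊗ G) ⊕ (M ⊗ (F ⊗ G))) ⊜ ((A ⊕ (M ⊗ F)) ⊗ G)) ≈-refl (constP a) (mono p) (expand p f) (expand p g) ⟩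
  mulP (expand p (a ∷ f)) (expand p g) ∎
  where open ≈-Reasoning

expand-constP : ∀ p c → expand p (constP c) ≈ constP c
expand-constP p c = ≈-trans (addP-cong (≈-refl {constP c}) (mulP-zeroʳ (mono p))) (addP-identityʳ (constP c))

expand-mono : ∀ p n → 1 ≤ p → expand p (mono n) ≈ mono (n ℕ.* p)
expand-mono p zero    1≤p = expand-constP p 1ℤ
expand-mono p (suc n) 1≤p =
  ≈-trans (expand-shiftP p (mono n)) (≈-trans (mulP-cong (≈-refl {mono p}) (expand-mono p n 1≤p)) (mono-+ p (n ℕ.* p)))

expand-x^−1 : ∀ p n → 1 ≤ p → expand p (x^ n −1) ≈ x^ (n ℕ.* p) −1
expand-x^−1 p n 1≤p = ≈-trans (expand-addP p (mono n) (constP (- 1ℤ)) 1≤p) (addP-cong (expand-mono p n 1≤p) (expand-constP p (- 1ℤ)))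

expand-prodTo : ∀ p n F → 1 ≤ p → expand p (prodTo n F) ≈ prodTo n (λ d → expand p (F d))
expand-prodTo p zero    F 1≤p = expand-constP p 1ℤ
expand-prodTo p (suc n) F 1≤p = ≈-trans (expand-mulP p (prodTo n F) (F (suc n)) 1≤p) (mulP-cong (expand-prodTo p n F 1≤p) ≈-refl)

when-⇔ : ∀ {A B : Set} (a : Dec A) (b : Dec B) f → (A → B) → (B → A) → when a f ≡ when b f
when-⇔ (yes _)  (yes _)  f _   _   = refl
when-⇔ (yes A′) (no ¬B)  f A⇒B _   = ⊥-elim (¬B (A⇒B A′))
when-⇔ (no ¬A)  (yes B′) f _   B⇒A = ⊥-elim (¬A (B⇒A B′))
when-⇔ (no _)   (no _)   f _   _   = refl

∣m*p⇒∣m : ∀ {p e} m → Prime p → ¬ p ∣ e → e ∣ m ℕ.* p → e ∣ m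
∣m*p⇒∣m {p} {e} m p-prime p∤e e∣mp = coprime-divisor coprime (subst (e ∣_) (ℕ.*-comm m p) e∣mp)
  where
  coprime : Coprime e p
  coprime (c∣e , c∣p) with prime⇒irreducible p-prime c∣p
  ... | inj₁ c≡1 = c≡1
  ... | inj₂ refl = ⊥-elim (p∤e c∣e)

-- Both sides of x ^ (m p) - 1 = ∏_{e ∣ m p} Φ e are split into the divisors of m and the remaining
-- multiples of p; comparing with (x ^ m - 1)(x ^ p) = ∏_{d ∣ m} Φ d (x ^ p) and cancelling the
-- factors d < m (known by induction) leaves Φ m (x ^ p) = Φ m Φ (m p).
module ExpandΦStep (p : ℕ) (p-prime : Prime p) (k : ℕ)
                   (ih : ∀ d → InRange k d → ¬ p ∣ d → expand p (Φ d) ≈ mulP (Φ d) (Φ (d ℕ.* p)))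
                   (p∤m : ¬ p ∣ suc k) where
  m = suc k
  n = m ℕ.* p

  1≤p : 1 ≤ p
  1≤p = ℕ.>-nonZero⁻¹ p {{prime⇒nonZero p-prime}}

  instance
    p≢0 : ℕ.NonZero p
    p≢0 = prime⇒nonZero p-prime

  1≤m : 1 ≤ m
  1≤m = s≤s z≤n

  Dm = prodTo k (onDivisorsOf m Φ)
  Em = prodTo k (onDivisorsOf m (λ d → Φ (d ℕ.* p)))


  expand-x^m−1 : x^ n −1 ≈ mulP (mulP Dm Em) (expand p (Φ m))
  expand-x^m−1 = begin
    x^ n −1                                                   ≈⟨ expand-x^−1 p m 1≤p ⟨
    expand p (x^ m −1)                                        ≈⟨ expand-cong p 1≤p (Φ-factorisation m 1≤m) ⟨
    expand p (prodTo m (onDivisorsOf m Φ))                    ≈⟨ expand-prodTo p m (onDivisorsOf m Φ) 1≤p ⟩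
    prodTo m (λ d → expand p (onDivisorsOf m Φ d))            ≈⟨ mulP-cong (prodTo-cong k (λ d d∈k → by-ih d d∈k (d ∣? m)))
                                                                            (≈-reflexive (cong (expand p) (onDivisorsOf-self m Φ))) ⟩
    mulP (prodTo k (λ d → mulP (onDivisorsOf m Φ d) (onDivisorsOf m (λ d → Φ (d ℕ.* p)) d))) (expand p (Φ m))
                                                              ≈⟨ mulP-cong (prodTo-mulP k _ _) ≈-refl ⟩
    mulP (mulP Dm Em) (expand p (Φ m))                        ∎
    where
    open ≈-Reasoning
    by-ih : ∀ d → InRange k d → (d∣?m : Dec (d ∣ m)) →
            expand p (when d∣?m (Φ d)) ≈ mulP (when d∣?m (Φ d)) (when d∣?m (Φ (d ℕ.* p)))
    by-ih d d∈k (yes d∣m) = ih d d∈k (λ p∣d → p∤m (∣-trans p∣d d∣m))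
    by-ih d d∈k (no  _)   = ≈-trans (expand-constP p 1ℤ) (≈-sym (mulP-identityˡ oneP))

  divisors-of-m : prodTo n (onDivisorsOf m Φ) ≈ mulP Dm (Φ m)
  divisors-of-m = ≈-trans (prodTo-onDivisorsOf-beyond m n Φ 1≤m (ℕ.m≤m*n m p)) (prodTo-onDivisorsOf-suc k Φ)

  multiples-of-p : prodTo n (λ e → when ((e ∣? n) ×-dec (p ∣? e)) (Φ e)) ≈ mulP Em (Φ n)
  multiples-of-p = begin
    prodTo n (λ e → when ((e ∣? n) ×-dec (p ∣? e)) (Φ e))
      ≈⟨ prodTo-reindex m p _ 1≤p (λ e p∤e → ≈-reflexive (when-no ((e ∣? n) ×-dec (p ∣? e)) (Φ e) (p∤e ∘ proj₂))) ⟩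
    prodTo m (λ j → when ((j ℕ.* p ∣? n) ×-dec (p ∣? j ℕ.* p)) (Φ (j ℕ.* p)))
      ≈⟨ prodTo-cong m (λ j _ → ≈-reflexive (when-⇔ ((j ℕ.* p ∣? n) ×-dec (p ∣? j ℕ.* p)) (j ∣? m) (Φ (j ℕ.* p))
                                 (*-cancelʳ-∣ p ∘ proj₁) λ j∣m → *-monoˡ-∣ p j∣m , n∣m*n j)) ⟩
    prodTo m (onDivisorsOf m (λ j → Φ (j ℕ.* p)))
      ≈⟨ prodTo-onDivisorsOf-suc k (λ j → Φ (j ℕ.* p)) ⟩
    mulP Em (Φ n) ∎
    where open ≈-Reasoning

  factorise-x^n−1 : x^ n −1 ≈ mulP (mulP Dm (Φ m)) (mulP Em (Φ n))
  factorise-x^n−1 = begin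
    x^ n −1
      ≈⟨ Φ-factorisation n (ℕ.≤-trans 1≤m (ℕ.m≤m*n m p)) ⟨
    prodTo n (onDivisorsOf n Φ)
      ≈⟨ prodTo-cong n (λ e _ → when-split (e ∣? n) (e ∣? m) ((e ∣? n) ×-dec (p ∣? e)) (Φ e)
                          (λ e∣n → divisor-cases e e∣n (p ∣? e)) (∣m⇒∣m*n p) proj₁ λ e∣m (_ , p∣e) → p∤m (∣-trans p∣e e∣m)) ⟩
    prodTo n (λ e → mulP (onDivisorsOf m Φ e) (when ((e ∣? n) ×-dec (p ∣? e)) (Φ e)))
      ≈⟨ prodTo-mulP n _ _ ⟩
    mulP (prodTo n (onDivisorsOf m Φ)) (prodTo n (λ e → when ((e ∣? n) ×-dec (p ∣? e)) (Φ e)))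
      ≈⟨ mulP-cong divisors-of-m multiples-of-p ⟩
    mulP (mulP Dm (Φ m)) (mulP Em (Φ n)) ∎
    where
    open ≈-Reasoning
    divisor-cases : ∀ e → e ∣ n → Dec (p ∣ e) → e ∣ m ⊎ (e ∣ n × p ∣ e)
    divisor-cases e e∣n (yes p∣e) = inj₂ (e∣n , p∣e)
    divisor-cases e e∣n (no  p∤e) = inj₁ (∣m*p⇒∣m m p-prime p∤e e∣n)

  UnitConstant-DmEm : UnitConstant (mulP Dm Em)
  UnitConstant-DmEm = UnitConstant-mulP Dm Em
    (UnitConstant-prodTo k _ λ d (1≤d , _) → UnitConstant-when (d ∣? m) (Φ d) (Φ-UnitConstant d 1≤d))
    (UnitConstant-prodTo k _ λ d (1≤d , _) → UnitConstant-when (d ∣? m) (Φ (d ℕ.* p))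
                                               (Φ-UnitConstant (d ℕ.* p) (ℕ.≤-trans 1≤d (ℕ.m≤m*n d p))))

  expand-Φm : expand p (Φ m) ≈ mulP (Φ m) (Φ n)
  expand-Φm = mulP-cancelˡ (mulP Dm Em) _ _ (UnitConstant⇒coeff₀≢0 (mulP Dm Em) UnitConstant-DmEm) (begin
    mulP (mulP Dm Em) (expand p (Φ m))       ≈⟨ expand-x^m−1 ⟨
    x^ n −1                                  ≈⟨ factorise-x^n−1 ⟩
    mulP (mulP Dm (Φ m)) (mulP Em (Φ n))     ≈⟨ solveP 4 (λ D A E B → ((D ⊗ A) ⊗ (E ⊗ B)) ⊜ ((D ⊗ E) ⊗ (A ⊗ B))) ≈-refl Dm (Φ m) Em (Φ n) ⟩
    mulP (mulP Dm Em) (mulP (Φ m) (Φ n))     ∎)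
    where open ≈-Reasoning

expand-Φ : ∀ p → Prime p → ∀ m → 1 ≤ m → ¬ p ∣ m → expand p (Φ m) ≈ mulP (Φ m) (Φ (m ℕ.* p))
expand-Φ p p-prime = InRange-induction (λ m → ¬ p ∣ m → expand p (Φ m) ≈ mulP (Φ m) (Φ (m ℕ.* p))) (ExpandΦStep.expand-Φm p p-prime)

-- Gaps between consecutive blocks

-- Only the term f_D c_s survives.
coeff-mulP-gap-start : ∀ f c D s → IsDeg f D → coeff c s ≢ 0ℤ → (∀ k → s < k → k ≤ s ℕ.+ D → coeff c k ≡ 0ℤ) →
                       coeff (mulP f c) (s ℕ.+ D) ≢ 0ℤ
coeff-mulP-gap-start f c D s (f_D≢0 , deg≤D) c_s≢0 gap fc≡0 =
  *-≢0 f_D≢0 (subst (λ k → coeff c k ≢ 0ℤ) (sym (ℕ.m+n∸n≡m s D)) c_s≢0)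
       (trans (sym (coeff-mulP-single f c (s ℕ.+ D) D (ℕ.m≤n+m D s) others)) fc≡0)
  where
  others : ∀ i → i ≤ s ℕ.+ D → i ≢ D → coeff f i * coeff c (s ℕ.+ D ∸ i) ≡ 0ℤ
  others i _ i≢D with ℕ.<-cmp i D
  ... | tri≈ _ i≡D _ = ⊥-elim (i≢D i≡D)
  ... | tri> _ _ D<i = *-≡0ˡ _ (deg≤D i D<i)
  ... | tri< i<D _ _ = *-≡0ʳ (coeff f i) (gap (s ℕ.+ D ∸ i) s<s+D∸i (ℕ.m∸n≤m (s ℕ.+ D) i))
    where
    s<s+D∸i : s < s ℕ.+ D ∸ i
    s<s+D∸i = +-<⇒<∸ i (subst (i ℕ.+ s <_) (ℕ.+-comm D s) (ℕ.+-monoˡ-< s i<D))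

-- Only the term f_0 c_t survives.
coeff-mulP-gap-end : ∀ f c D t → coeff f 0 ≢ 0ℤ → DegreeAtMost f D → coeff c t ≢ 0ℤ → (∀ k → t ∸ D ≤ k → k < t → coeff c k ≡ 0ℤ) →
                     coeff (mulP f c) t ≢ 0ℤ
coeff-mulP-gap-end f c D t f₀≢0 deg≤D c_t≢0 gap fc≡0 =
  *-≢0 f₀≢0 c_t≢0 (trans (sym (coeff-mulP-single f c t 0 z≤n others)) fc≡0)
  where
  others : ∀ i → i ≤ t → i ≢ 0 → coeff f i * coeff c (t ∸ i) ≡ 0ℤ
  others i i≤t i≢0 with D ℕ.<? i
  ... | yes D<i = *-≡0ˡ _ (deg≤D i D<i)
  ... | no  D≮i = *-≡0ʳ (coeff f i) (gap (t ∸ i) (ℕ.∸-monoʳ-≤ t (ℕ.≮⇒≥ D≮i)) (ℕ.∸-monoʳ-< {t} {i} {0} (ℕ.n≢0⇒n>0 i≢0) i≤t))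

coeff-block : ∀ m p i t → t < p → coeff (block m p i) t ≡ coeff (Φ (m ℕ.* p)) (i ℕ.* p ℕ.+ t)
coeff-block m p i t t<p = trans (cong (λ l → coeff l t) (map-upTo _ p)) (coeff-applyUpTo< _ p t t<p)

block-nonzero⇒< : ∀ m p i t → coeff (block m p i) t ≢ 0ℤ → t < p
block-nonzero⇒< m p i t bₜ≢0 = ℕ.≰⇒> λ p≤t → bₜ≢0 (trans (cong (λ l → coeff l t) (map-upTo _ p)) (coeff-applyUpTo≥ _ p t p≤t))

coeff-Φ-from-block : ∀ m p i k → i ℕ.* p ≤ k → k < i ℕ.* p ℕ.+ p → coeff (Φ (m ℕ.* p)) k ≡ coeff (block m p i) (k ∸ i ℕ.* p)
coeff-Φ-from-block m p i k ip≤k k<ip+p =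
  trans (cong (coeff (Φ (m ℕ.* p))) (sym (ℕ.m+[n∸m]≡n ip≤k))) (sym (coeff-block m p i (k ∸ i ℕ.* p) (<+⇒∸< ip≤k k<ip+p)))

Φ-vanishes-between-blocks : ∀ m p i a b → IsTdeg (block m p (suc i)) a → IsDeg (block m p i) b →
                            ∀ k → i ℕ.* p ℕ.+ b < k → k < suc i ℕ.* p ℕ.+ a → coeff (Φ (m ℕ.* p)) k ≡ 0ℤ
Φ-vanishes-between-blocks m p i a b (a≢0 , below-a) (_ , above-b) k s<k k<t with k ℕ.<? i ℕ.* p ℕ.+ p
... | yes k<ip+p = trans (coeff-Φ-from-block m p i k (ℕ.m+n≤o⇒m≤o (i ℕ.* p) (ℕ.<⇒≤ s<k)) k<ip+p)
                         (above-b (k ∸ i ℕ.* p) (+-<⇒<∸ (i ℕ.* p) s<k))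
... | no  k≮ip+p = trans (coeff-Φ-from-block m p (suc i) k P≤k (ℕ.<-trans k<t (ℕ.+-monoʳ-< P a<p)))
                         (below-a (k ∸ P) (<+⇒∸< P≤k k<t))
  where
  P = suc i ℕ.* p
  P≤k : P ≤ k
  P≤k = subst (_≤ k) (ℕ.+-comm (i ℕ.* p) p) (ℕ.≮⇒≥ k≮ip+p)
  a<p = block-nonzero⇒< m p (suc i) a a≢0

∤-multiple+ : ∀ {p} X r → p ∣ X → 1 ≤ r → r < p → ¬ p ∣ X ℕ.+ r
∤-multiple+ X r p∣X 1≤r r<p p∣X+r = ℕ.<⇒≱ r<p (∣⇒≤ {{ℕ.>-nonZero 1≤r}} (∣m+n∣m⇒∣n p∣X+r p∣X))

block-gap-bound : ∀ m p → 1 ≤ m → Prime p → ¬ p ∣ m → ∀ i a b →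
                  IsTdeg (block m p (suc i)) a → IsDeg (block m p i) b → p ℕ.+ a ≤ b ℕ.+ φ m
block-gap-bound m p 1≤m p-prime p∤m i a b tdeg deg = ℕ.≮⇒≥ λ b+D<p+a → edge-nonzero b+D<p+a (a ℕ.≟ 0)
  where
  D = φ m
  s = i ℕ.* p ℕ.+ b
  t = suc i ℕ.* p ℕ.+ a
  a<p = block-nonzero⇒< m p (suc i) a (proj₁ tdeg)
  gap : ∀ k → s < k → k < t → coeff (Φ (m ℕ.* p)) k ≡ 0ℤ
  gap = Φ-vanishes-between-blocks m p i a b tdeg deg
  cₛ≢0 : coeff (Φ (m ℕ.* p)) s ≢ 0ℤ
  cₛ≢0 = proj₁ deg ∘ trans (coeff-block m p i b (block-nonzero⇒< m p i b (proj₁ deg)))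
  cₜ≢0 : coeff (Φ (m ℕ.* p)) t ≢ 0ℤ
  cₜ≢0 = proj₁ tdeg ∘ trans (coeff-block m p (suc i) a a<p)
  off-multiples : ∀ k → ¬ p ∣ k → coeff (mulP (Φ m) (Φ (m ℕ.* p))) k ≡ 0ℤ
  off-multiples k p∤k = trans (sym (coeff-≈ (expand-Φ p p-prime m 1≤m p∤m) k))
                              (coeff-expand-other p (Φ m) k (ℕ.>-nonZero⁻¹ p {{prime⇒nonZero p-prime}}) p∤k)
  s+D<t : b ℕ.+ D < p ℕ.+ a → s ℕ.+ D < t
  s+D<t b+D<p+a = subst₂ _<_ (sym (ℕ.+-assoc (i ℕ.* p) b D))
                             (trans (sym (ℕ.+-assoc (i ℕ.* p) p a)) (cong (ℕ._+ a) (ℕ.+-comm (i ℕ.* p) p)))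
                             (ℕ.+-monoʳ-< (i ℕ.* p) b+D<p+a)
  edge-nonzero : b ℕ.+ D < p ℕ.+ a → Dec (a ≡ 0) → ⊥
  edge-nonzero b+D<p+a (yes refl) =
    coeff-mulP-gap-start (Φ m) (Φ (m ℕ.* p)) D s (Φ-IsDeg m 1≤m) cₛ≢0
      (λ k s<k k≤s+D → gap k s<k (ℕ.≤-<-trans k≤s+D (s+D<t b+D<p+a)))
      (off-multiples (s ℕ.+ D) (subst (λ k → ¬ p ∣ k) (sym (ℕ.+-assoc (i ℕ.* p) b D))
        (∤-multiple+ (i ℕ.* p) (b ℕ.+ D) (n∣m*n i) (ℕ.≤-trans (1≤φ m 1≤m) (ℕ.m≤n+m D b)) (subst (b ℕ.+ D <_) (ℕ.+-identityʳ p) b+D<p+a))))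
  edge-nonzero b+D<p+a (no a≢0) =
    coeff-mulP-gap-end (Φ m) (Φ (m ℕ.* p)) D t (UnitConstant⇒coeff₀≢0 (Φ m) (Φ-UnitConstant m 1≤m)) (proj₂ (Φ-IsDeg m 1≤m)) cₜ≢0
      (λ k t∸D≤k k<t → gap k (ℕ.<-≤-trans (+-<⇒<∸ D (subst (_< t) (ℕ.+-comm s D) (s+D<t b+D<p+a))) t∸D≤k) k<t)
      (off-multiples t (∤-multiple+ (suc i ℕ.* p) a (n∣m*n (suc i)) (ℕ.n≢0⇒n>0 a≢0) a<p))

+-−+-≤ : ∀ {x y z} → x ≤ y ℕ.+ z → + x - + y ℤ.≤ + z
+-−+-≤ {x} {y} {z} x≤y+z = subst (+ x - + y ℤ.≤_) (solve 2 (λ a b → (a :+ b) :- a := b) refl (+ y) (+ z)) (ℤ.+-monoˡ-≤ (- + y) (ℤ.+≤+ x≤y+z))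

mainTheorem11 : (m p : ℕ) → 1 ≤ m → Prime p → m < p →
    (i : ℕ) → i < φ m → (g : ℤ) → IsGapB m p i g → g ℤ.≤ + φ m
mainTheorem11 m p 1≤m p-prime m<p zero    _ g g≡0 = subst (ℤ._≤ + φ m) (sym g≡0) (ℤ.+≤+ z≤n)
mainTheorem11 m p 1≤m p-prime m<p (suc i) _ g (a , b , tdeg , deg , g≡p+a-b) =
  subst (ℤ._≤ + φ m) (sym g≡p+a-b) (+-−+-≤ (block-gap-bound m p 1≤m p-prime p∤m i a b tdeg deg))
  where
  p∤m : ¬ p ∣ m
  p∤m p∣m = ℕ.<⇒≱ m<p (∣⇒≤ {{ℕ.>-nonZero 1≤m}} p∣m)
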